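{- Let $A$ be a binary matrix with $n\ge 4$ columns and let $v\in\{0,1,2\}^n$. If $M[A]$ is $3$-connected and $M[\Gamma(A,v)]$ is cosimple, then $M[\Gamma(A,v)]$ is $3$-connected.
   Context: For a binary matrix $A$, $M[A]$ is the binary matroid represented by $A$ over $GF(2)$ (on its columns). Let $A$ have columns $c_1,\dots,c_n$ and $v=(v_1,\dots,v_n)\in\{0,1,2\}^n$; let $\bar v_i$ be the remainder of $v_i$ modulo $2$, and let $i_1<\dots<i_k$ be the indices $j$ with $v_j=2$. Then $\Gamma(A,v)$ is the binary matrix with one more row than $A$ whose columns are, in order: the column with $1$ in the new top row and $0$ elsewhere; for $i=1,\dots,n$, the column with top entry $\bar v_i$ followed by $c_i$; and for $t=1,\dots,k$, the column with top entry $1$ followed by $c_{i_t}$. A matroid is cosimple if it has no coloops and no cocircuits of size $2$. -}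

module Defs where

open import Data.Nat using (ℕ; zero; suc; _+_; _≤_; _<_)
open import Data.Bool using (Bool; true; false; if_then_else_; _xor_)
open import Data.Fin using (Fin; zero; suc)
open import Data.Vec using (Vec; []; _∷_; replicate; zipWith)
open import Data.List using (List; []; _∷_; _++_; length; lookup)
open import Data.Fin.Subset using (Subset; _⊆_; _⊂_; ∁; ⊤; _∩_; ∣_∣; Nonempty; Empty; _∈_)
open import Data.Product using (Σ; ∃; _×_; _,_)
open import Relation.Nullary using (¬_)
open import Relation.Binary.PropositionalEquality using (_≡_; _≢_)

-- Binary matrices over GF(2) = Bool (addition = xor).
-- A binary matrix with m rows and N columns is given by its columns:
--   cols : Fin N → Vec Bool m.
-- M[A] is the matroid on the column index set Fin N.

colSum : ∀ {m N} → (Fin N → Vec Bool m) → Subset N → Vec Bool m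
colSum {m} {zero}  c []      = replicate m false
colSum {m} {suc N} c (b ∷ Y) =
  if b then zipWith _xor_ (c zero) (colSum (λ i → c (suc i)) Y)
       else colSum (λ i → c (suc i)) Y

-- Independence in M[A]: the columns in X are linearly independent over GF(2),
-- i.e. no nontrivial GF(2)-linear combination (= nonempty subset sum) vanishes.
Indep : ∀ {m N} → (Fin N → Vec Bool m) → Subset N → Set
Indep {m} c X = ∀ Y → Y ⊆ X → Nonempty Y → colSum c Y ≢ replicate m false

IsRank : ∀ {m N} → (Fin N → Vec Bool m) → Subset N → ℕ → Set
IsRank c X k =
  (∃ λ Y → Y ⊆ X × Indep c Y × ∣ Y ∣ ≡ k) ×
  (∀ Y → Y ⊆ X → Indep c Y → ∣ Y ∣ ≤ k)

Basis : ∀ {m N} → (Fin N → Vec Bool m) → Subset N → Set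
Basis c B = Indep c B × (∀ Y → B ⊂ Y → ¬ Indep c Y)

Coloop : ∀ {m N} → (Fin N → Vec Bool m) → Fin N → Set
Coloop c e = ∀ B → Basis c B → e ∈ B

Cocircuit : ∀ {m N} → (Fin N → Vec Bool m) → Subset N → Set
Cocircuit c C =
  (∀ B → Basis c B → Nonempty (C ∩ B)) ×
  (∀ D → D ⊂ C → ∃ λ B → Basis c B × Empty (D ∩ B))

Cosimple : ∀ {m N} → (Fin N → Vec Bool m) → Set
Cosimple c =
  (∀ e → ¬ Coloop c e) × (∀ C → Cocircuit c C → ¬ (∣ C ∣ ≡ 2))

Separation : ∀ {m N} → (Fin N → Vec Bool m) → ℕ → Subset N → Set
Separation c k X =
  k ≤ ∣ X ∣ × k ≤ ∣ ∁ X ∣ ×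
  (∃ λ rX → ∃ λ rY → ∃ λ rE →
     IsRank c X rX × IsRank c (∁ X) rY × IsRank c ⊤ rE × rX + rY < k + rE)

ThreeConnected : ∀ {m N} → (Fin N → Vec Bool m) → Set
ThreeConnected c = ∀ k → 1 ≤ k → k < 3 → ∀ X → ¬ Separation c k X

-- The construction Γ(A, v),  v ∈ {0,1,2}^n encoded as Fin 3.

parity : Fin 3 → Bool
parity zero             = false
parity (suc zero)       = true
parity (suc (suc zero)) = false

isTwo : Fin 3 → Bool
isTwo (suc (suc zero)) = true
isTwo _                = false

-- columns (v̄_i ; c_i), i = 1..n
middleCols : ∀ {m n} → (Fin n → Vec Bool m) → (Fin n → Fin 3) → List (Vec Bool (suc m))
middleCols {m} {zero}  A v = []
middleCols {m} {suc n} A v =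
  (parity (v zero) ∷ A zero) ∷ middleCols (λ i → A (suc i)) (λ i → v (suc i))

-- columns (1 ; c_{i_t}) for the indices with v_i = 2, in increasing order
twoCols : ∀ {m n} → (Fin n → Vec Bool m) → (Fin n → Fin 3) → List (Vec Bool (suc m))
twoCols {m} {zero}  A v = []
twoCols {m} {suc n} A v =
  let rest = twoCols (λ i → A (suc i)) (λ i → v (suc i)) in
  if isTwo (v zero) then (true ∷ A zero) ∷ rest else rest

ΓList : ∀ {m n} → (Fin n → Vec Bool m) → (Fin n → Fin 3) → List (Vec Bool (suc m))
ΓList {m} A v = (true ∷ replicate m false) ∷ (middleCols A v ++ twoCols A v)

ΓN : ∀ {m n} → (Fin n → Vec Bool m) → (Fin n → Fin 3) → ℕ
ΓN A v = length (ΓList A v)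

Γ : ∀ {m n} (A : Fin n → Vec Bool m) (v : Fin n → Fin 3) → Fin (ΓN A v) → Vec Bool (suc m)
Γ A v = lookup (ΓList A v)

module Submission where

-- Write c = Γ(A,v) and e for its first column (1;0).  Every other column of c
-- is (b ; A i) for some column A i of A, each A i occurs this way, and the
-- columns other than e are pairwise distinct.  For a set S of columns of c let
-- π S be the set of columns of A occurring below elements of S.  Linear algebra
-- gives  r_A(π S) ≤ r_c(S)  and  r_c(S ∪ e) = r_A(π S) + 1.  Hence a
-- k-separation (X, Y) of M[c] with e ∈ X yields  r_A(π X) + r_A(π Y) < k + r(A),
-- and since π X ∪ π Y covers A, (π Y, ∁ π Y) is a k-separation of M[A] unless
-- one side is small.  The small cases force a coloop or a series pair in M[c],
-- which cosimplicity forbids.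

open import Defs
open import Data.Nat using (ℕ; zero; suc; _+_; _∸_; _≤_; _<_; z≤n; s≤s; _≤?_)
open import Data.Nat.Properties
  using (≤-trans; ≤-refl; ≤-reflexive; ≤-antisym; ≤-<-trans; ≮⇒≥; ≰⇒>;
         +-cancelˡ-<; +-cancelʳ-<; +-cancelʳ-≤; +-monoˡ-≤; +-monoʳ-≤; +-mono-≤; +-suc; +-comm;
         ≤-pred; ∸-monoˡ-≤; <⇒≱; module ≤-Reasoning)
open import Data.Bool using (Bool; true; false; if_then_else_; _xor_; _∧_)
import Data.Bool.Properties as BoolP
open import Data.Fin using (Fin; zero; suc)
import Data.Fin.Properties as FinP
open import Data.Vec using (Vec; []; _∷_; replicate; zipWith; lookup; head; tail; tabulate)
import Data.Vec.Properties as VecP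
open import Data.Vec.Base using (here; there)
open import Data.Fin.Subset
  using (Subset; _⊆_; _⊂_; ∁; ⊤; ⊥; _∩_; _∪_; ∣_∣; Nonempty; Empty; _∈_; _∉_; ⁅_⁆; _-_)
open import Data.Fin.Subset.Properties
  using (_∈?_; _⊆?_; anySubset?; nonempty?; Empty-unique; ⊥⊆; ∉⊥; ⊆⊤; ∈⊤; ⊆-antisym;
         x∈⁅x⁆; x∈⁅y⁆⇒x≡y; x≢y⇒x∉⁅y⁆; ∣⁅x⁆∣≡1; ∣⊥∣≡0; ∣∁p∣≡n∸∣p∣; ∣p∣≤∣x∷p∣;
         p⊆q⇒∣p∣≤∣q∣; p⊂q⇒∣p∣<∣q∣; x∈p∪q⁻; x∈p∪q⁺; p⊆p∪q; x∈p∩q⁺; x∈p∩q⁻;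
         x∈p⇒x∉∁p; x∈∁p⇒x∉p; x∉∁p⇒x∈p; x∉p⇒x∈∁p; p─q⊆p; p─⊥≡p; drop-∷-⊆; drop-there;
         ∪-identityʳ)
open import Data.List using (List; []; _∷_; _++_; allFin)
import Data.List as List
import Data.List.Relation.Unary.Any as Any
open import Data.List.Relation.Unary.Any.Properties using (lookup-index)
import Data.List.Relation.Unary.All as All
open import Data.List.Relation.Unary.Unique.Propositional using (Unique)
open import Data.List.Relation.Unary.AllPairs using ([]; _∷_)
import Data.List.Relation.Unary.Unique.Propositional.Properties as Unique
open import Data.List.Relation.Binary.Disjoint.Propositional using (Disjoint)
open import Data.List.Membership.Propositional using () renaming (_∈_ to _∈ₗ_)
open import Data.List.Membership.Propositional.Properties
  using (∈-allFin; ∈-tabulate⁺; ∈-tabulate⁻; ∈-lookup; ∈-++⁻; ∈-++⁺ˡ)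
open import Data.Product using (∃; _×_; _,_; proj₁; proj₂)
open import Data.Sum using (_⊎_; inj₁; inj₂; [_,_])
open import Data.Empty using (⊥-elim) renaming (⊥ to False)
open import Relation.Nullary using (¬_; Dec; yes; no; ¬?)
open import Relation.Nullary.Decidable using (_×-dec_; isYes)
open import Relation.Binary.PropositionalEquality
  using (_≡_; _≢_; refl; sym; trans; cong; cong₂; subst; module ≡-Reasoning)

infixl 6 _⊕_

_⊕_ : ∀ {m} → Vec Bool m → Vec Bool m → Vec Bool m
_⊕_ = zipWith _xor_

0v : ∀ {m} → Vec Bool m
0v = replicate _ false

⊕-identityˡ : ∀ {m} (x : Vec Bool m) → 0v ⊕ x ≡ x
⊕-identityˡ = VecP.zipWith-identityˡ BoolP.xor-identityˡ

⊕-identityʳ : ∀ {m} (x : Vec Bool m) → x ⊕ 0v ≡ x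
⊕-identityʳ = VecP.zipWith-identityʳ BoolP.xor-identityʳ

⊕-comm : ∀ {m} (x y : Vec Bool m) → x ⊕ y ≡ y ⊕ x
⊕-comm = VecP.zipWith-comm BoolP.xor-comm

⊕-assoc : ∀ {m} (x y z : Vec Bool m) → (x ⊕ y) ⊕ z ≡ x ⊕ (y ⊕ z)
⊕-assoc = VecP.zipWith-assoc BoolP.xor-assoc

⊕-self : ∀ {m} (x : Vec Bool m) → x ⊕ x ≡ 0v
⊕-self []      = refl
⊕-self (a ∷ x) = cong₂ _∷_ (BoolP.xor-same a) (⊕-self x)

⊕-interchange : ∀ {m} (a b c d : Vec Bool m) → (a ⊕ b) ⊕ (c ⊕ d) ≡ (a ⊕ c) ⊕ (b ⊕ d)
⊕-interchange a b c d = begin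
  (a ⊕ b) ⊕ (c ⊕ d)  ≡⟨ ⊕-assoc a b (c ⊕ d) ⟩
  a ⊕ (b ⊕ (c ⊕ d))  ≡⟨ cong (a ⊕_) (sym (⊕-assoc b c d)) ⟩
  a ⊕ ((b ⊕ c) ⊕ d)  ≡⟨ cong (λ t → a ⊕ (t ⊕ d)) (⊕-comm b c) ⟩
  a ⊕ ((c ⊕ b) ⊕ d)  ≡⟨ cong (a ⊕_) (⊕-assoc c b d) ⟩
  a ⊕ (c ⊕ (b ⊕ d))  ≡⟨ sym (⊕-assoc a c (b ⊕ d)) ⟩
  (a ⊕ c) ⊕ (b ⊕ d)  ∎
  where open ≡-Reasoning

⊕-cancelʳ : ∀ {m} (x y : Vec Bool m) → (x ⊕ y) ⊕ y ≡ x
⊕-cancelʳ x y = begin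
  (x ⊕ y) ⊕ y  ≡⟨ ⊕-assoc x y y ⟩
  x ⊕ (y ⊕ y)  ≡⟨ cong (x ⊕_) (⊕-self y) ⟩
  x ⊕ 0v       ≡⟨ ⊕-identityʳ x ⟩
  x            ∎
  where open ≡-Reasoning

⊕≡0⇒≡ : ∀ {m} (x y : Vec Bool m) → x ⊕ y ≡ 0v → x ≡ y
⊕≡0⇒≡ x y eq = begin
  x            ≡⟨ sym (⊕-cancelʳ x y) ⟩
  (x ⊕ y) ⊕ y  ≡⟨ cong (_⊕ y) eq ⟩
  0v ⊕ y       ≡⟨ ⊕-identityˡ y ⟩
  y            ∎
  where open ≡-Reasoning

⊕-solve : ∀ {m} (x y z : Vec Bool m) → x ⊕ y ≡ z → x ≡ z ⊕ y
⊕-solve x y z eq = trans (sym (⊕-cancelʳ x y)) (cong (_⊕ y) eq)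

⊕-top : ∀ {m} {a b : Bool} (u : Vec Bool m) → a ≢ b → (a ∷ u) ⊕ (b ∷ u) ≡ true ∷ 0v
⊕-top {a = true}  {true}  u ne = ⊥-elim (ne refl)
⊕-top {a = true}  {false} u ne = cong (true ∷_) (⊕-self u)
⊕-top {a = false} {true}  u ne = cong (true ∷_) (⊕-self u)
⊕-top {a = false} {false} u ne = ⊥-elim (ne refl)

bool-dichotomy : ∀ {a b : Bool} → a ≢ b → ∀ x → x ≡ a ⊎ x ≡ b
bool-dichotomy {true}  {true}  a≢b x     = ⊥-elim (a≢b refl)
bool-dichotomy {false} {false} a≢b x     = ⊥-elim (a≢b refl)
bool-dichotomy {true}  {false} a≢b true  = inj₁ refl
bool-dichotomy {true}  {false} a≢b false = inj₂ refl
bool-dichotomy {false} {true}  a≢b true  = inj₂ refl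
bool-dichotomy {false} {true}  a≢b false = inj₁ refl

head∷tail : ∀ {m} (x : Vec Bool (suc m)) → x ≡ head x ∷ tail x
head∷tail (a ∷ x) = refl

_≟v_ : ∀ {m} (x y : Vec Bool m) → Dec (x ≡ y)
_≟v_ = VecP.≡-dec BoolP._≟_

-- Column sums.  A subset of Fin N is a Bool vector, so _⊕_ on subsets is
-- symmetric difference, and colSum c is GF(2)-linear in the subset.

scale : ∀ {m} → Bool → Vec Bool m → Vec Bool m
scale b u = if b then u else 0v

scale-xor : ∀ {m} (a b : Bool) (u : Vec Bool m) → scale (a xor b) u ≡ scale a u ⊕ scale b u
scale-xor true  true  u = sym (⊕-self u)
scale-xor true  false u = sym (⊕-identityʳ u)
scale-xor false b     u = sym (⊕-identityˡ (scale b u))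

colSum-∷ : ∀ {m N} (c : Fin (suc N) → Vec Bool m) b Y →
  colSum c (b ∷ Y) ≡ scale b (c zero) ⊕ colSum (λ i → c (suc i)) Y
colSum-∷ c true  Y = refl
colSum-∷ c false Y = sym (⊕-identityˡ _)

colSum-⊥ : ∀ {m N} (c : Fin N → Vec Bool m) → colSum c ⊥ ≡ 0v
colSum-⊥ {N = zero}  c = refl
colSum-⊥ {N = suc N} c = colSum-⊥ (λ i → c (suc i))

colSum-empty : ∀ {m} (c : Fin 0 → Vec Bool m) (Y : Subset 0) → colSum c Y ≡ 0v
colSum-empty c [] = refl

colSum-⁅⁆ : ∀ {m N} (c : Fin N → Vec Bool m) x → colSum c ⁅ x ⁆ ≡ c x
colSum-⁅⁆ {N = suc N} c zero    = trans (cong (c zero ⊕_) (colSum-⊥ (λ i → c (suc i)))) (⊕-identityʳ (c zero))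
colSum-⁅⁆ {N = suc N} c (suc x) = colSum-⁅⁆ (λ i → c (suc i)) x

colSum-⊕ : ∀ {m N} (c : Fin N → Vec Bool m) (Y Z : Subset N) →
  colSum c (Y ⊕ Z) ≡ colSum c Y ⊕ colSum c Z
colSum-⊕ {N = zero}  c []      []      = sym (⊕-identityˡ 0v)
colSum-⊕ {m} {suc N} c (a ∷ Y) (b ∷ Z) = begin
  colSum c ((a xor b) ∷ (Y ⊕ Z))
    ≡⟨ colSum-∷ c (a xor b) (Y ⊕ Z) ⟩
  scale (a xor b) (c zero) ⊕ colSum c' (Y ⊕ Z)
    ≡⟨ cong₂ _⊕_ (scale-xor a b (c zero)) (colSum-⊕ c' Y Z) ⟩
  (scale a (c zero) ⊕ scale b (c zero)) ⊕ (colSum c' Y ⊕ colSum c' Z)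
    ≡⟨ ⊕-interchange _ _ _ _ ⟩
  (scale a (c zero) ⊕ colSum c' Y) ⊕ (scale b (c zero) ⊕ colSum c' Z)
    ≡⟨ sym (cong₂ _⊕_ (colSum-∷ c a Y) (colSum-∷ c b Z)) ⟩
  colSum c (a ∷ Y) ⊕ colSum c (b ∷ Z) ∎
  where
  open ≡-Reasoning
  c' : Fin N → Vec Bool m
  c' i = c (suc i)

colSum-scale : ∀ {m N} (c : Fin N → Vec Bool m) b Y → colSum c (scale b Y) ≡ scale b (colSum c Y)
colSum-scale c true  Y = refl
colSum-scale c false Y = colSum-⊥ c

colSum-pointwise : ∀ {m N} (c d : Fin N → Vec Bool m) Y →
  colSum (λ x → c x ⊕ d x) Y ≡ colSum c Y ⊕ colSum d Y
colSum-pointwise {N = zero}  c d [] = sym (⊕-identityˡ 0v)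
colSum-pointwise {N = suc N} c d (true ∷ Y) =
  trans (cong ((c zero ⊕ d zero) ⊕_) (colSum-pointwise _ _ Y)) (⊕-interchange (c zero) (d zero) _ _)
colSum-pointwise {N = suc N} c d (false ∷ Y) = colSum-pointwise _ _ Y

colSum-multiples : ∀ {m N} (f : Fin N → Bool) (u : Vec Bool m) Y →
  ∃ λ b → colSum (λ x → scale (f x) u) Y ≡ scale b u
colSum-multiples {N = zero}  f u []      = false , refl
colSum-multiples {N = suc N} f u (a ∷ Y) with colSum-multiples (λ x → f (suc x)) u Y
... | b , eq = (a ∧ f zero) xor b , (begin
  colSum (λ x → scale (f x) u) (a ∷ Y)
    ≡⟨ colSum-∷ (λ x → scale (f x) u) a Y ⟩
  scale a (scale (f zero) u) ⊕ colSum (λ x → scale (f (suc x)) u) Y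
    ≡⟨ cong₂ _⊕_ (scale-∧ a (f zero)) eq ⟩
  scale (a ∧ f zero) u ⊕ scale b u
    ≡⟨ sym (scale-xor (a ∧ f zero) b u) ⟩
  scale ((a ∧ f zero) xor b) u ∎)
  where
  open ≡-Reasoning
  scale-∧ : ∀ a b → scale a (scale b u) ≡ scale (a ∧ b) u
  scale-∧ true  b = refl
  scale-∧ false b = refl

colSum-tail : ∀ {m N} (c : Fin N → Vec Bool (suc m)) Y →
  tail (colSum c Y) ≡ colSum (λ x → tail (c x)) Y
colSum-tail {N = zero}  c [] = refl
colSum-tail {N = suc N} c (true ∷ Y) with c zero | head∷tail (colSum (λ i → c (suc i)) Y)
... | a ∷ u | split = trans (cong (λ w → tail ((a ∷ u) ⊕ w)) split) (cong (u ⊕_) (colSum-tail _ Y))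
colSum-tail {N = suc N} c (false ∷ Y) = colSum-tail _ Y

colSum-pad : ∀ {m N} (f : Fin N → Vec Bool m) Y →
  colSum (λ x → false ∷ f x) Y ≡ false ∷ colSum f Y
colSum-pad {N = zero}  f [] = refl
colSum-pad {N = suc N} f (true ∷ Y)  = cong ((false ∷ f zero) ⊕_) (colSum-pad _ Y)
colSum-pad {N = suc N} f (false ∷ Y) = colSum-pad _ Y

∈⇒lookup : ∀ {N} {x : Fin N} {p : Subset N} → x ∈ p → lookup p x ≡ true
∈⇒lookup = VecP.[]=⇒lookup

lookup⇒∈ : ∀ {N} {x : Fin N} {p : Subset N} → lookup p x ≡ true → x ∈ p
lookup⇒∈ {x = x} {p} = VecP.lookup⇒[]= x p

∉⇒lookup : ∀ {N} {x : Fin N} (p : Subset N) → x ∉ p → lookup p x ≡ false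
∉⇒lookup {x = x} p x∉p with lookup p x in eq
... | true  = ⊥-elim (x∉p (lookup⇒∈ eq))
... | false = refl

∈-⊕ : ∀ {N} {x : Fin N} (Y Z : Subset N) → x ∈ Y ⊕ Z → x ∈ Y ⊎ x ∈ Z
∈-⊕ {x = x} Y Z x∈ with lookup Y x in eqY
... | true  = inj₁ (lookup⇒∈ eqY)
... | false = inj₂ (lookup⇒∈ (trans (sym lookup-Y⊕Z) (∈⇒lookup x∈)))
  where
  lookup-Y⊕Z : lookup (Y ⊕ Z) x ≡ lookup Z x
  lookup-Y⊕Z = trans (VecP.lookup-zipWith _xor_ x Y Z) (cong (_xor lookup Z x) eqY)

⊕-⊆ : ∀ {N} {Y Z J : Subset N} → Y ⊆ J → Z ⊆ J → Y ⊕ Z ⊆ J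
⊕-⊆ {Y = Y} {Z} Y⊆J Z⊆J x∈ = [ Y⊆J , Z⊆J ] (∈-⊕ Y Z x∈)

∈-⊕⁅⁆ : ∀ {N} {x : Fin N} (Y : Subset N) → x ∉ Y → x ∈ Y ⊕ ⁅ x ⁆
∈-⊕⁅⁆ {x = x} Y x∉Y = lookup⇒∈ (begin
  lookup (Y ⊕ ⁅ x ⁆) x            ≡⟨ VecP.lookup-zipWith _xor_ x Y ⁅ x ⁆ ⟩
  lookup Y x xor lookup ⁅ x ⁆ x   ≡⟨ cong₂ _xor_ (∉⇒lookup Y x∉Y) (∈⇒lookup (x∈⁅x⁆ x)) ⟩
  true                            ∎)
  where open ≡-Reasoning

⁅⁆⊆ : ∀ {N} {x : Fin N} {J} → x ∈ J → ⁅ x ⁆ ⊆ J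
⁅⁆⊆ {x = x} x∈J y∈ = subst (_∈ _) (sym (x∈⁅y⁆⇒x≡y x y∈)) x∈J

x∉p-x : ∀ {N} (p : Subset N) x → x ∉ p - x
x∉p-x (b ∷ p) zero    ()
x∉p-x (b ∷ p) (suc x) (there x∈) = x∉p-x p x x∈

∣p∣≡1+∣p-x∣ : ∀ {N} (p : Subset N) x → x ∈ p → ∣ p ∣ ≡ suc ∣ p - x ∣
∣p∣≡1+∣p-x∣ (true ∷ p) zero    here       = cong (λ q → suc ∣ q ∣) (sym (p─⊥≡p p))
∣p∣≡1+∣p-x∣ (true ∷ p) (suc x) (there x∈) = cong suc (∣p∣≡1+∣p-x∣ p x x∈)
∣p∣≡1+∣p-x∣ (false ∷ p) (suc x) (there x∈) = ∣p∣≡1+∣p-x∣ p x x∈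

∣p∪⁅x⁆∣≡1+∣p∣ : ∀ {N} (p : Subset N) x → x ∉ p → ∣ p ∪ ⁅ x ⁆ ∣ ≡ suc ∣ p ∣
∣p∪⁅x⁆∣≡1+∣p∣ (true ∷ p)  zero    x∉ = ⊥-elim (x∉ here)
∣p∪⁅x⁆∣≡1+∣p∣ (false ∷ p) zero    x∉ = cong (λ q → suc ∣ q ∣) (∪-identityʳ p)
∣p∪⁅x⁆∣≡1+∣p∣ (true ∷ p)  (suc x) x∉ = cong suc (∣p∪⁅x⁆∣≡1+∣p∣ p x (λ x∈ → x∉ (there x∈)))
∣p∪⁅x⁆∣≡1+∣p∣ (false ∷ p) (suc x) x∉ = ∣p∪⁅x⁆∣≡1+∣p∣ p x (λ x∈ → x∉ (there x∈))

∁-involutive : ∀ {N} (p : Subset N) → ∁ (∁ p) ≡ p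
∁-involutive p = ⊆-antisym (λ x∈ → x∉∁p⇒x∈p (x∈∁p⇒x∉p x∈)) (λ x∈ → x∉p⇒x∈∁p (x∈p⇒x∉∁p x∈))

∈-∪⁅⁆ : ∀ {N} {S : Subset N} {x y} → y ∈ S ∪ ⁅ x ⁆ → y ≢ x → y ∈ S
∈-∪⁅⁆ {S = S} {x} y∈ y≢x = [ (λ y∈S → y∈S) , (λ y∈x → ⊥-elim (y≢x (x∈⁅y⁆⇒x≡y x y∈x))) ] (x∈p∪q⁻ S ⁅ x ⁆ y∈)

pair : ∀ {N} → Fin N → Fin N → Subset N
pair x y = ⁅ x ⁆ ∪ ⁅ y ⁆

∈-pair₁ : ∀ {N} {x y : Fin N} → x ∈ pair x y
∈-pair₁ {x = x} = x∈p∪q⁺ (inj₁ (x∈⁅x⁆ x))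

∈-pair₂ : ∀ {N} {x y : Fin N} → y ∈ pair x y
∈-pair₂ {y = y} = x∈p∪q⁺ (inj₂ (x∈⁅x⁆ y))

∈-pair⁻ : ∀ {N} {x y t : Fin N} → t ∈ pair x y → t ≡ x ⊎ t ≡ y
∈-pair⁻ {x = x} {y} t∈ with x∈p∪q⁻ ⁅ x ⁆ ⁅ y ⁆ t∈
... | inj₁ t∈x = inj₁ (x∈⁅y⁆⇒x≡y x t∈x)
... | inj₂ t∈y = inj₂ (x∈⁅y⁆⇒x≡y y t∈y)

pair⊆ : ∀ {N} {S : Subset N} {x y} → x ∈ S → y ∈ S → pair x y ⊆ S
pair⊆ x∈S y∈S t∈ with ∈-pair⁻ t∈
... | inj₁ refl = x∈S
... | inj₂ refl = y∈S

∣pair∣≡2 : ∀ {N} (x y : Fin N) → x ≢ y → ∣ pair x y ∣ ≡ 2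
∣pair∣≡2 x y x≢y = trans (∣p∪⁅x⁆∣≡1+∣p∣ ⁅ x ⁆ y (x≢y⇒x∉⁅y⁆ (λ y≡x → x≢y (sym y≡x)))) (cong suc (∣⁅x⁆∣≡1 x))

element : ∀ {N} (S : Subset N) → 1 ≤ ∣ S ∣ → ∃ λ x → x ∈ S
element {N} S 1≤∣S∣ with nonempty? S
... | yes x∈S = x∈S
... | no  S-empty with subst (1 ≤_) (trans (cong ∣_∣ (Empty-unique S-empty)) (∣⊥∣≡0 N)) 1≤∣S∣
... | ()

two-elements : ∀ {N} (S : Subset N) → 2 ≤ ∣ S ∣ → ∃ λ x → ∃ λ y → x ∈ S × y ∈ S × x ≢ y
two-elements S 2≤∣S∣ with element S (≤-trans (s≤s z≤n) 2≤∣S∣)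
... | x , x∈S with element (S - x) (≤-pred (subst (2 ≤_) (∣p∣≡1+∣p-x∣ S x x∈S) 2≤∣S∣))
... | y , y∈S-x = x , y , x∈S , p─q⊆p S ⁅ x ⁆ y∈S-x , λ x≡y → x∉p-x S x (subst (_∈ S - x) (sym x≡y) y∈S-x)

∈⇒1≤∣∣ : ∀ {N} {S : Subset N} {x} → x ∈ S → 1 ≤ ∣ S ∣
∈⇒1≤∣∣ {x = x} x∈S = subst (_≤ _) (∣⁅x⁆∣≡1 x) (p⊆q⇒∣p∣≤∣q∣ (⁅⁆⊆ x∈S))

∣∣≤1⇒≡ : ∀ {N} (S : Subset N) {x y} → ∣ S ∣ ≤ 1 → x ∈ S → y ∈ S → x ≡ y
∣∣≤1⇒≡ S {x} {y} ∣S∣≤1 x∈S y∈S with x FinP.≟ y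
... | yes x≡y = x≡y
... | no  x≢y with ≤-trans (subst (_≤ ∣ S ∣) (∣pair∣≡2 x y x≢y) (p⊆q⇒∣p∣≤∣q∣ (pair⊆ x∈S y∈S))) ∣S∣≤1
... | s≤s ()

InSpan : ∀ {m N} → (Fin N → Vec Bool m) → Subset N → Vec Bool m → Set
InSpan c J w = ∃ λ Z → Z ⊆ J × colSum c Z ≡ w

Spans : ∀ {m N} → (Fin N → Vec Bool m) → Subset N → Subset N → Set
Spans c J X = ∀ {x} → x ∈ X → InSpan c J (c x)

span-0 : ∀ {m N} (c : Fin N → Vec Bool m) J → InSpan c J 0v
span-0 c J = ⊥ , ⊥⊆ , colSum-⊥ c

span-⊕ : ∀ {m N} (c : Fin N → Vec Bool m) {J u w} → InSpan c J u → InSpan c J w → InSpan c J (u ⊕ w)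
span-⊕ c (Y , Y⊆J , ΣY) (Z , Z⊆J , ΣZ) = Y ⊕ Z , ⊕-⊆ Y⊆J Z⊆J , trans (colSum-⊕ c Y Z) (cong₂ _⊕_ ΣY ΣZ)

span-mono : ∀ {m N} (c : Fin N → Vec Bool m) {J J' w} → J ⊆ J' → InSpan c J w → InSpan c J' w
span-mono c J⊆J' (Z , Z⊆J , ΣZ) = Z , (λ z∈ → J⊆J' (Z⊆J z∈)) , ΣZ

span-el : ∀ {m N} (c : Fin N → Vec Bool m) {J x} → x ∈ J → InSpan c J (c x)
span-el c {x = x} x∈J = ⁅ x ⁆ , ⁅⁆⊆ x∈J , colSum-⁅⁆ c x

span-colSum : ∀ {m N N'} (c : Fin N → Vec Bool m) (d : Fin N' → Vec Bool m) J Z →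
  (∀ {z} → z ∈ Z → InSpan d J (c z)) → InSpan d J (colSum c Z)
span-colSum {N = zero}  c d J []      h = span-0 d J
span-colSum {N = suc N} c d J (true ∷ Z)  h =
  span-⊕ d (h here) (span-colSum (λ i → c (suc i)) d J Z (λ z∈ → h (there z∈)))
span-colSum {N = suc N} c d J (false ∷ Z) h = span-colSum (λ i → c (suc i)) d J Z (λ z∈ → h (there z∈))

span-Spans : ∀ {m N} (c : Fin N → Vec Bool m) {J X w} → Spans c J X → InSpan c X w → InSpan c J w
span-Spans c {J} J↠X (Z , Z⊆X , ΣZ) = subst (InSpan c J) ΣZ (span-colSum c c J Z (λ z∈ → J↠X (Z⊆X z∈)))

span? : ∀ {m N} (c : Fin N → Vec Bool m) J w → Dec (InSpan c J w)
span? c J w = anySubset? (λ Z → (Z ⊆? J) ×-dec (colSum c Z ≟v w))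

indep⇒≢0 : ∀ {m N} (c : Fin N → Vec Bool m) {I x} → Indep c I → x ∈ I → c x ≢ 0v
indep⇒≢0 c {x = x} ind x∈I cx≡0 = ind ⁅ x ⁆ (⁅⁆⊆ x∈I) (x , x∈⁅x⁆ x) (trans (colSum-⁅⁆ c x) cx≡0)

p≡p-x⊕⁅x⁆ : ∀ {N} (p : Subset N) x → x ∈ p → p ≡ (p - x) ⊕ ⁅ x ⁆
p≡p-x⊕⁅x⁆ (true ∷ p) zero    here       = cong (true ∷_) (sym (trans (⊕-identityʳ _) (p─⊥≡p p)))
p≡p-x⊕⁅x⁆ (b ∷ p)    (suc x) (there x∈) = cong₂ _∷_ (sym (BoolP.xor-identityʳ b)) (p≡p-x⊕⁅x⁆ p x x∈)

colSum-remove : ∀ {m N} (c : Fin N → Vec Bool m) {Z x} → x ∈ Z → colSum c Z ≡ colSum c (Z - x) ⊕ c x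
colSum-remove c {Z} {x} x∈Z = begin
  colSum c Z                           ≡⟨ cong (colSum c) (p≡p-x⊕⁅x⁆ Z x x∈Z) ⟩
  colSum c ((Z - x) ⊕ ⁅ x ⁆)          ≡⟨ colSum-⊕ c (Z - x) ⁅ x ⁆ ⟩
  colSum c (Z - x) ⊕ colSum c ⁅ x ⁆    ≡⟨ cong (colSum c (Z - x) ⊕_) (colSum-⁅⁆ c x) ⟩
  colSum c (Z - x) ⊕ c x               ∎
  where open ≡-Reasoning

⊆∪⁅⁆⇒⊆ : ∀ {N} {Z S : Subset N} {x} → Z ⊆ S ∪ ⁅ x ⁆ → x ∉ Z → Z ⊆ S
⊆∪⁅⁆⇒⊆ {Z = Z} Z⊆ x∉Z z∈ = ∈-∪⁅⁆ (Z⊆ z∈) (λ z≡x → x∉Z (subst (_∈ Z) z≡x z∈))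

⊆∪⁅⁆⇒-⊆ : ∀ {N} {Z S : Subset N} {x} → Z ⊆ S ∪ ⁅ x ⁆ → Z - x ⊆ S
⊆∪⁅⁆⇒-⊆ {Z = Z} {x = x} Z⊆ z∈ = ∈-∪⁅⁆ (Z⊆ (p─q⊆p Z ⁅ x ⁆ z∈)) (λ z≡x → x∉p-x Z x (subst (_∈ Z - x) z≡x z∈))

span-∪⁅⁆⁻ : ∀ {m N} (c : Fin N → Vec Bool m) {S x w} → InSpan c (S ∪ ⁅ x ⁆) w →
  InSpan c S w ⊎ InSpan c S (w ⊕ c x)
span-∪⁅⁆⁻ c {S} {x} {w} (Z , Z⊆ , ΣZ) with x ∈? Z
... | no  x∉Z = inj₁ (Z , ⊆∪⁅⁆⇒⊆ Z⊆ x∉Z , ΣZ)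
... | yes x∈Z = inj₂ (Z - x , ⊆∪⁅⁆⇒-⊆ Z⊆ , ⊕-solve _ (c x) w (trans (sym (colSum-remove c x∈Z)) ΣZ))

indep-extend : ∀ {m N} (c : Fin N → Vec Bool m) {B x} → Indep c B → ¬ InSpan c B (c x) → Indep c (B ∪ ⁅ x ⁆)
indep-extend c {B} {x} ind x∉span Y Y⊆ Y≢∅ ΣY≡0 with x ∈? Y
... | no  x∉Y = ind Y (⊆∪⁅⁆⇒⊆ Y⊆ x∉Y) Y≢∅ ΣY≡0
... | yes x∈Y = x∉span (Y - x , ⊆∪⁅⁆⇒-⊆ Y⊆ , ⊕≡0⇒≡ _ _ (trans (sym (colSum-remove c x∈Y)) ΣY≡0))

scale-⊕ : ∀ {m} b (x y : Vec Bool m) → scale b (x ⊕ y) ≡ scale b x ⊕ scale b y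
scale-⊕ true  x y = refl
scale-⊕ false x y = sym (⊕-identityˡ 0v)

scale-⊆ : ∀ {N} b {Y J : Subset N} → Y ⊆ J → scale b Y ⊆ J
scale-⊆ true  Y⊆J = Y⊆J
scale-⊆ false Y⊆J = ⊥⊆

-- Gaussian elimination of d₀: if u = h·d₀ + s and w = d₀ + t, then u + h·w = s + h·t.
eliminate : ∀ {m} h (d₀ s t : Vec Bool m) → (scale h d₀ ⊕ s) ⊕ scale h (d₀ ⊕ t) ≡ s ⊕ scale h t
eliminate {m} h d₀ s t = begin
  (a ⊕ s) ⊕ scale h (d₀ ⊕ t)   ≡⟨ cong ((a ⊕ s) ⊕_) (scale-⊕ h d₀ t) ⟩
  (a ⊕ s) ⊕ (a ⊕ scale h t)    ≡⟨ ⊕-interchange a s a (scale h t) ⟩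
  (a ⊕ a) ⊕ (s ⊕ scale h t)    ≡⟨ cong (_⊕ (s ⊕ scale h t)) (⊕-self a) ⟩
  0v ⊕ (s ⊕ scale h t)         ≡⟨ ⊕-identityˡ (s ⊕ scale h t) ⟩
  s ⊕ scale h t                ∎
  where
  open ≡-Reasoning
  a : Vec Bool m
  a = scale h d₀

tail-⊆ : ∀ {N} {v : Subset (suc N)} {b J} → v ⊆ b ∷ J → tail v ⊆ J
tail-⊆ {v = a ∷ v} v⊆ = drop-∷-⊆ v⊆

head⇒zero∈ : ∀ {N} (v : Subset (suc N)) → head v ≡ true → zero ∈ v
head⇒zero∈ (true ∷ v) refl = here

colSum-skip-first : ∀ {m N} (d : Fin (suc N) → Vec Bool m) (Y : Subset (suc N)) → head Y ≡ false →
  colSum (λ j → d (suc j)) (tail Y) ≡ colSum d Y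
colSum-skip-first d (false ∷ Y) refl = refl

-- Eliminating d₀ from a representation U by means of a representation V that uses d₀:
-- U ⊕ (head U)·V no longer uses d₀ and represents Σ U ⊕ (head U)·Σ V.
colSum-eliminate : ∀ {m N} (d : Fin (suc N) → Vec Bool m) (U V : Subset (suc N)) → head V ≡ true →
  colSum (λ j → d (suc j)) (tail U ⊕ scale (head U) (tail V)) ≡ colSum d U ⊕ scale (head U) (colSum d V)
colSum-eliminate {m} d (h ∷ U) (true ∷ V) refl = begin
  colSum d' (U ⊕ scale h V)                  ≡⟨ trans (colSum-⊕ d' U _) (cong (s ⊕_) (colSum-scale d' h V)) ⟩
  s ⊕ scale h t                              ≡⟨ sym (eliminate h (d zero) s t) ⟩
  (scale h (d zero) ⊕ s) ⊕ scale h (d zero ⊕ t)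
                                             ≡⟨ sym (cong (_⊕ scale h (d zero ⊕ t)) (colSum-∷ d h U)) ⟩
  colSum d (h ∷ U) ⊕ scale h (colSum d (true ∷ V)) ∎
  where
  open ≡-Reasoning
  d' : Fin _ → Vec Bool m
  d' j = d (suc j)
  s t : Vec Bool m
  s = colSum d' U
  t = colSum d' V

indep-shear : ∀ {m N} (c : Fin N → Vec Bool m) {I i₀} → Indep c I → i₀ ∈ I → (f : Fin N → Bool) →
  Indep (λ x → c x ⊕ scale (f x) (c i₀)) (I - i₀)
indep-shear c {I} {i₀} ind i₀∈I f Y Y⊆ Y≢∅ ΣY≡0 with colSum-multiples f (c i₀) Y
... | b , Σshift = refute b (begin
  colSum c Y ⊕ scale b (c i₀)                              ≡⟨ cong (colSum c Y ⊕_) (sym Σshift) ⟩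
  colSum c Y ⊕ colSum (λ x → scale (f x) (c i₀)) Y         ≡⟨ sym (colSum-pointwise c _ Y) ⟩
  colSum (λ x → c x ⊕ scale (f x) (c i₀)) Y                ≡⟨ ΣY≡0 ⟩
  0v                                                       ∎)
  where
  open ≡-Reasoning
  Y⊆I : Y ⊆ I
  Y⊆I y∈ = p─q⊆p I ⁅ i₀ ⁆ (Y⊆ y∈)
  i₀∉Y : i₀ ∉ Y
  i₀∉Y i₀∈Y = x∉p-x I i₀ (Y⊆ i₀∈Y)
  refute : ∀ b → colSum c Y ⊕ scale b (c i₀) ≡ 0v → False
  refute false ΣY⊕0≡0 = ind Y Y⊆I Y≢∅ (trans (sym (⊕-identityʳ _)) ΣY⊕0≡0)
  refute true  ΣY⊕ci₀≡0 =
    ind (Y ⊕ ⁅ i₀ ⁆) (⊕-⊆ Y⊆I (⁅⁆⊆ i₀∈I)) (i₀ , ∈-⊕⁅⁆ Y i₀∉Y)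
        (trans (colSum-⊕ c Y ⁅ i₀ ⁆) (trans (cong (colSum c Y ⊕_) (colSum-⁅⁆ c i₀)) ΣY⊕ci₀≡0))

-- Induction on J:
-- if no representation uses the first column d₀ of d, drop it; otherwise some
-- W i₀ uses d₀, and shearing by c i₀ removes d₀ from all representations.
steinitz-rep : ∀ {m N N'} (c : Fin N → Vec Bool m) (d : Fin N' → Vec Bool m) (I : Subset N) (J : Subset N')
  (W : Fin N → Subset N') → Indep c I → (∀ {i} → i ∈ I → W i ⊆ J) →
  (∀ {i} → i ∈ I → colSum d (W i) ≡ c i) → ∣ I ∣ ≤ ∣ J ∣
steinitz-rep {N = N} {N' = zero} c d I [] W ind W⊆J ΣW with nonempty? I
... | yes (i , i∈I) = ⊥-elim (indep⇒≢0 c ind i∈I (trans (sym (ΣW i∈I)) (colSum-empty d (W i))))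
... | no  I-empty  = ≤-reflexive (trans (cong ∣_∣ (Empty-unique I-empty)) (∣⊥∣≡0 N))
steinitz-rep {m} {N} {suc N'} c d I (b ∷ J) W ind W⊆J ΣW
  with FinP.any? (λ i → (i ∈? I) ×-dec (head (W i) BoolP.≟ true))
... | no none-uses-d₀ = ≤-trans (steinitz-rep c d' I J (λ i → tail (W i)) ind (λ i∈ → tail-⊆ (W⊆J i∈)) Σtail)
                               (∣p∣≤∣x∷p∣ b J)
  where
  d' : Fin N' → Vec Bool m
  d' j = d (suc j)
  Σtail : ∀ {i} → i ∈ I → colSum d' (tail (W i)) ≡ c i
  Σtail {i} i∈I = trans (colSum-skip-first d (W i) (BoolP.¬-not (λ h → none-uses-d₀ (i , i∈I , h)))) (ΣW i∈I)
... | yes (i₀ , i₀∈I , i₀-uses-d₀) with W⊆J i₀∈I (head⇒zero∈ (W i₀) i₀-uses-d₀)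
... | here = subst (_≤ suc ∣ J ∣) (sym (∣p∣≡1+∣p-x∣ I i₀ i₀∈I))
                   (s≤s (steinitz-rep c' d' (I - i₀) J W' (indep-shear c ind i₀∈I uses) W'⊆J ΣW'))
  where
  d' : Fin N' → Vec Bool m
  d' j = d (suc j)
  -- whether the representation of c x uses d₀
  uses : Fin N → Bool
  uses x = head (W x)
  c' : Fin N → Vec Bool m
  c' x = c x ⊕ scale (uses x) (c i₀)
  W' : Fin N → Subset N'
  W' x = tail (W x) ⊕ scale (uses x) (tail (W i₀))
  I-i₀⊆I : I - i₀ ⊆ I
  I-i₀⊆I = p─q⊆p I ⁅ i₀ ⁆
  W'⊆J : ∀ {i} → i ∈ I - i₀ → W' i ⊆ J
  W'⊆J i∈ = ⊕-⊆ (tail-⊆ (W⊆J (I-i₀⊆I i∈))) (scale-⊆ (uses _) (tail-⊆ (W⊆J i₀∈I)))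
  ΣW' : ∀ {i} → i ∈ I - i₀ → colSum d' (W' i) ≡ c' i
  ΣW' {i} i∈ = trans (colSum-eliminate d (W i) (W i₀) i₀-uses-d₀)
                     (cong₂ (λ u w → u ⊕ scale (uses i) w) (ΣW (I-i₀⊆I i∈)) (ΣW i₀∈I))

steinitz : ∀ {m N N'} (c : Fin N → Vec Bool m) (d : Fin N' → Vec Bool m) (I : Subset N) (J : Subset N') →
  Indep c I → (∀ {i} → i ∈ I → InSpan d J (c i)) → ∣ I ∣ ≤ ∣ J ∣
steinitz c d I J ind J↠I = steinitz-rep c d I J (λ i → rep i (i ∈? I)) ind rep⊆J Σrep
  where
  rep : ∀ i → Dec (i ∈ I) → Subset _
  rep i (yes i∈I) = proj₁ (J↠I i∈I)
  rep i (no  _)   = ⊥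
  rep⊆J : ∀ {i} → i ∈ I → rep i (i ∈? I) ⊆ J
  rep⊆J {i} i∈I with i ∈? I
  ... | yes i∈I' = proj₁ (proj₂ (J↠I i∈I'))
  ... | no  i∉I  = ⊥-elim (i∉I i∈I)
  Σrep : ∀ {i} → i ∈ I → colSum d (rep i (i ∈? I)) ≡ c i
  Σrep {i} i∈I with i ∈? I
  ... | yes i∈I' = proj₂ (proj₂ (J↠I i∈I'))
  ... | no  i∉I  = ⊥-elim (i∉I i∈I)

-- Rank.  A greedy scan over all columns produces, for every X, an independent
-- B ⊆ X spanning X; by Steinitz its size is the rank of X.

greedy : ∀ {m N} (c : Fin N → Vec Bool m) X (xs : List (Fin N)) →
  ∃ λ B → B ⊆ X × Indep c B × (∀ {x} → x ∈ₗ xs → x ∈ X → InSpan c B (c x))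
greedy c X [] = ⊥ , ⊥⊆ , (λ Y Y⊆⊥ (y , y∈Y) _ → ∉⊥ (Y⊆⊥ y∈Y)) , λ ()
greedy c X (x ∷ xs) with greedy c X xs | x ∈? X
... | B , B⊆X , ind , B↠ | no x∉X = B , B⊆X , ind , B↠'
  where
  B↠' : ∀ {y} → y ∈ₗ x ∷ xs → y ∈ X → InSpan c B (c y)
  B↠' (Any.here refl) x∈X = ⊥-elim (x∉X x∈X)
  B↠' (Any.there y∈)  y∈X = B↠ y∈ y∈X
... | B , B⊆X , ind , B↠ | yes x∈X with span? c B (c x)
...   | yes x∈span = B , B⊆X , ind , B↠'
  where
  B↠' : ∀ {y} → y ∈ₗ x ∷ xs → y ∈ X → InSpan c B (c y)
  B↠' (Any.here refl) _   = x∈span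
  B↠' (Any.there y∈)  y∈X = B↠ y∈ y∈X
...   | no  x∉span = B ∪ ⁅ x ⁆ , B∪x⊆X , indep-extend c ind x∉span , B↠'
  where
  B∪x⊆X : B ∪ ⁅ x ⁆ ⊆ X
  B∪x⊆X y∈ = [ B⊆X , (λ y∈x → subst (_∈ X) (sym (x∈⁅y⁆⇒x≡y x y∈x)) x∈X) ] (x∈p∪q⁻ B ⁅ x ⁆ y∈)
  B↠' : ∀ {y} → y ∈ₗ x ∷ xs → y ∈ X → InSpan c (B ∪ ⁅ x ⁆) (c y)
  B↠' (Any.here refl) _   = span-el c (x∈p∪q⁺ (inj₂ (x∈⁅x⁆ x)))
  B↠' (Any.there y∈)  y∈X = span-mono c (p⊆p∪q ⁅ x ⁆) (B↠ y∈ y∈X)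

basis : ∀ {m N} (c : Fin N → Vec Bool m) → Subset N → Subset N
basis c X = proj₁ (greedy c X (allFin _))

basis⊆ : ∀ {m N} (c : Fin N → Vec Bool m) X → basis c X ⊆ X
basis⊆ c X = proj₁ (proj₂ (greedy c X (allFin _)))

basis-indep : ∀ {m N} (c : Fin N → Vec Bool m) X → Indep c (basis c X)
basis-indep c X = proj₁ (proj₂ (proj₂ (greedy c X (allFin _))))

basis-spans : ∀ {m N} (c : Fin N → Vec Bool m) X → Spans c (basis c X) X
basis-spans c X {x} = proj₂ (proj₂ (proj₂ (greedy c X (allFin _)))) (∈-allFin x)

rank : ∀ {m N} (c : Fin N → Vec Bool m) → Subset N → ℕ
rank c X = ∣ basis c X ∣

indep≤rank : ∀ {m N} (c : Fin N → Vec Bool m) {I X} → I ⊆ X → Indep c I → ∣ I ∣ ≤ rank c X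
indep≤rank c {I} {X} I⊆X ind = steinitz c c I (basis c X) ind (λ i∈ → basis-spans c X (I⊆X i∈))

rank-isRank : ∀ {m N} (c : Fin N → Vec Bool m) X → IsRank c X (rank c X)
rank-isRank c X = (basis c X , basis⊆ c X , basis-indep c X , refl) , λ Y Y⊆X ind → indep≤rank c Y⊆X ind

isRank⇒≡rank : ∀ {m N} (c : Fin N → Vec Bool m) {X k} → IsRank c X k → k ≡ rank c X
isRank⇒≡rank c {X} ((I , I⊆X , ind , ∣I∣≡k) , maximal) =
  ≤-antisym (subst (_≤ rank c X) ∣I∣≡k (indep≤rank c I⊆X ind)) (maximal (basis c X) (basis⊆ c X) (basis-indep c X))

rank-mono : ∀ {m N} (c : Fin N → Vec Bool m) {X Y} → X ⊆ Y → rank c X ≤ rank c Y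
rank-mono c {X} X⊆Y = indep≤rank c (λ x∈ → X⊆Y (basis⊆ c X x∈)) (basis-indep c X)

rank-spans : ∀ {m N} (c : Fin N → Vec Bool m) {X Y} → Spans c Y X → rank c X ≤ rank c Y
rank-spans c {X} {Y} Y↠X = steinitz c c (basis c X) (basis c Y) (basis-indep c X)
  (λ i∈ → span-Spans c (basis-spans c Y) (Y↠X (basis⊆ c X i∈)))

rank≤card : ∀ {m N} (c : Fin N → Vec Bool m) X → rank c X ≤ ∣ X ∣
rank≤card c X = p⊆q⇒∣p∣≤∣q∣ (basis⊆ c X)

rank-extend : ∀ {m N} (c : Fin N → Vec Bool m) X w → ¬ InSpan c X (c w) → suc (rank c X) ≤ rank c (X ∪ ⁅ w ⁆)
rank-extend {N = N} c X w w∉span = subst (_≤ rank c (X ∪ ⁅ w ⁆)) (∣p∪⁅x⁆∣≡1+∣p∣ B w w∉B)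
  (indep≤rank c B∪w⊆X∪w (indep-extend c (basis-indep c X) w∉spanB))
  where
  B : Subset N
  B = basis c X
  w∉spanB : ¬ InSpan c B (c w)
  w∉spanB w∈span = w∉span (span-mono c (basis⊆ c X) w∈span)
  w∉B : w ∉ B
  w∉B w∈B = w∉spanB (span-el c w∈B)
  B∪w⊆X∪w : B ∪ ⁅ w ⁆ ⊆ X ∪ ⁅ w ⁆
  B∪w⊆X∪w y∈ = [ (λ y∈B → x∈p∪q⁺ (inj₁ (basis⊆ c X y∈B))) , (λ y∈w → x∈p∪q⁺ (inj₂ y∈w)) ] (x∈p∪q⁻ B ⁅ w ⁆ y∈)

full-rank⇒spans : ∀ {m N} (c : Fin N → Vec Bool m) {S} → rank c ⊤ ≤ rank c S → ∀ w → InSpan c S (c w)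
full-rank⇒spans c {S} full w with span? c S (c w)
... | yes w∈span = w∈span
... | no  w∉span = ⊥-elim (<⇒≱ (rank-extend c S w w∉span) (≤-trans (rank-mono c ⊆⊤) full))

rank-absorb : ∀ {m N} (c : Fin N → Vec Bool m) X w → InSpan c X (c w) → rank c (X ∪ ⁅ w ⁆) ≤ rank c X
rank-absorb c X w w∈span = rank-spans c X↠X∪w
  where
  X↠X∪w : Spans c X (X ∪ ⁅ w ⁆)
  X↠X∪w y∈ = [ span-el c , (λ y∈w → subst (λ z → InSpan c X (c z)) (sym (x∈⁅y⁆⇒x≡y w y∈w)) w∈span) ]
               (x∈p∪q⁻ X ⁅ w ⁆ y∈)

-- A basis spans everything, so it has at least full rank.
Basis⇒full-rank : ∀ {m N} (c : Fin N → Vec Bool m) {B} → Basis c B → rank c ⊤ ≤ ∣ B ∣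
Basis⇒full-rank c {B} (ind , maximal) = steinitz c c (basis c ⊤) B (basis-indep c ⊤) (λ _ → B↠)
  where
  B↠ : ∀ {y} → InSpan c B (c y)
  B↠ {y} with span? c B (c y)
  ... | yes y∈span = y∈span
  ... | no  y∉span = ⊥-elim (maximal (B ∪ ⁅ y ⁆) (p⊆p∪q ⁅ y ⁆ , y , x∈p∪q⁺ (inj₂ (x∈⁅x⁆ y)) , λ y∈B → y∉span (span-el c y∈B))
                                       (indep-extend c ind y∉span))

full-rank⇒Basis : ∀ {m N} (c : Fin N → Vec Bool m) {B} → Indep c B → rank c ⊤ ≤ ∣ B ∣ → Basis c B
full-rank⇒Basis c {B} ind full = ind , λ Y B⊂Y indY →
  <⇒≱ (p⊂q⇒∣p∣<∣q∣ B⊂Y) (≤-trans (indep≤rank c ⊆⊤ indY) full)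

rank-drop⇒meets-bases : ∀ {m N} (c : Fin N → Vec Bool m) S → rank c (∁ S) < rank c ⊤ →
  ∀ B → Basis c B → Nonempty (S ∩ B)
rank-drop⇒meets-bases c S drop B isBasis with nonempty? (S ∩ B)
... | yes meets = meets
... | no  disjoint = ⊥-elim (<⇒≱ drop (≤-trans (Basis⇒full-rank c isBasis) (indep≤rank c B⊆∁S (proj₁ isBasis))))
  where
  B⊆∁S : B ⊆ ∁ S
  B⊆∁S x∈B = x∉p⇒x∈∁p (λ x∈S → disjoint (_ , x∈p∩q⁺ (x∈S , x∈B)))

coloop-of : ∀ {m N} (c : Fin N → Vec Bool m) x → rank c (∁ ⁅ x ⁆) < rank c ⊤ → Coloop c x
coloop-of c x drop B isBasis with rank-drop⇒meets-bases c ⁅ x ⁆ drop B isBasis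
... | y , y∈ with x∈p∩q⁻ ⁅ x ⁆ B y∈
... | y∈x , y∈B = subst (_∈ B) (x∈⁅y⁆⇒x≡y x y∈x) y∈B

-- A non-coloop is avoided by some basis (a basis of the deletion).
avoiding-basis : ∀ {m N} (c : Fin N → Vec Bool m) x → ¬ Coloop c x → ∃ λ B → Basis c B × x ∉ B
avoiding-basis c x not-coloop =
  B , full-rank⇒Basis c (basis-indep c (∁ ⁅ x ⁆)) (≮⇒≥ (λ drop → not-coloop (coloop-of c x drop))) ,
  λ x∈B → x∈p⇒x∉∁p (x∈⁅x⁆ x) (basis⊆ c (∁ ⁅ x ⁆) x∈B)
  where B = basis c (∁ ⁅ x ⁆)

⊂pair⇒⊆⁅⁆ : ∀ {N} {D : Subset N} {x y} → D ⊂ pair x y → D ⊆ ⁅ y ⁆ ⊎ D ⊆ ⁅ x ⁆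
⊂pair⇒⊆⁅⁆ {D = D} {x} {y} (D⊆ , z , z∈pair , z∉D) with ∈-pair⁻ z∈pair
... | inj₁ refl = inj₁ (λ t∈D → [ (λ t≡x → ⊥-elim (z∉D (subst (_∈ D) t≡x t∈D))) , (λ { refl → x∈⁅x⁆ _ }) ] (∈-pair⁻ (D⊆ t∈D)))
... | inj₂ refl = inj₂ (λ t∈D → [ (λ { refl → x∈⁅x⁆ _ }) , (λ t≡y → ⊥-elim (z∉D (subst (_∈ D) t≡y t∈D))) ] (∈-pair⁻ (D⊆ t∈D)))

cocircuit-pair : ∀ {m N} (c : Fin N → Vec Bool m) x y → (∀ e → ¬ Coloop c e) →
  rank c (∁ (pair x y)) < rank c ⊤ → Cocircuit c (pair x y)
cocircuit-pair c x y no-coloops drop = rank-drop⇒meets-bases c (pair x y) drop , minimal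
  where
  avoid : ∀ {D} u → D ⊆ ⁅ u ⁆ → ∃ λ B → Basis c B × Empty (D ∩ B)
  avoid {D} u D⊆u with avoiding-basis c u (no-coloops u)
  ... | B , isBasis , u∉B = B , isBasis , λ (t , t∈) →
        let (t∈D , t∈B) = x∈p∩q⁻ D B t∈ in u∉B (subst (_∈ B) (x∈⁅y⁆⇒x≡y u (D⊆u t∈D)) t∈B)
  minimal : ∀ D → D ⊂ pair x y → ∃ λ B → Basis c B × Empty (D ∩ B)
  minimal D D⊂ = [ avoid y , avoid x ] (⊂pair⇒⊆⁅⁆ D⊂)

cosimple⇒no-coloop : ∀ {m N} (c : Fin N → Vec Bool m) → Cosimple c → ∀ x → rank c ⊤ ≤ rank c (∁ ⁅ x ⁆)
cosimple⇒no-coloop c (no-coloops , _) x = ≮⇒≥ (λ drop → no-coloops x (coloop-of c x drop))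

cosimple⇒no-series-pair : ∀ {m N} (c : Fin N → Vec Bool m) → Cosimple c →
  ∀ x y → x ≢ y → rank c ⊤ ≤ rank c (∁ (pair x y))
cosimple⇒no-series-pair c (no-coloops , no-pairs) x y x≢y =
  ≮⇒≥ (λ drop → no-pairs (pair x y) (cocircuit-pair c x y no-coloops drop) (∣pair∣≡2 x y x≢y))

separation : ∀ {m N} (c : Fin N → Vec Bool m) k X → k ≤ ∣ X ∣ → k ≤ ∣ ∁ X ∣ →
  rank c X + rank c (∁ X) < k + rank c ⊤ → Separation c k X
separation c k X k≤∣X∣ k≤∣∁X∣ deficient =
  k≤∣X∣ , k≤∣∁X∣ , rank c X , rank c (∁ X) , rank c ⊤ , rank-isRank c X , rank-isRank c (∁ X) , rank-isRank c ⊤ , deficient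

separation-deficient : ∀ {m N} (c : Fin N → Vec Bool m) {k X} → Separation c k X →
  rank c X + rank c (∁ X) < k + rank c ⊤
separation-deficient c {k} (_ , _ , rX , rY , rE , isX , isY , isE , deficient)
  rewrite isRank⇒≡rank c isX | isRank⇒≡rank c isY | isRank⇒≡rank c isE = deficient

sum<-swap : ∀ a b {K} → a + b < K → b + a < K
sum<-swap a b {K} = subst (_< K) (+-comm a b)

sum<⇒right< : ∀ {a b k c} → a + b < k + c → k ≤ a → b < c
sum<⇒right< {a} {b} {k} {c} lt k≤a = +-cancelˡ-< k b c (≤-<-trans (+-monoˡ-≤ b k≤a) lt)

sum<⇒left< : ∀ {a b k c} → a + b < k + c → c ≤ b → a < k
sum<⇒left< {a} {b} {k} {c} lt c≤b = +-cancelʳ-< c a k (≤-<-trans (+-monoʳ-≤ a c≤b) lt)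

separation-swap : ∀ {m N} (c : Fin N → Vec Bool m) {k X} → Separation c k X → Separation c k (∁ X)
separation-swap c {k} {X} (k≤∣X∣ , k≤∣∁X∣ , rX , rY , rE , isX , isY , isE , deficient) =
  k≤∣∁X∣ , subst (λ T → k ≤ ∣ T ∣) (sym (∁-involutive X)) k≤∣X∣ ,
  rY , rX , rE , isY , subst (λ T → IsRank c T rX) (sym (∁-involutive X)) isX , isE , sum<-swap rX rY deficient

module ThreeConnectedMatrix {m n} (A : Fin n → Vec Bool m) (4≤n : 4 ≤ n) (tc : ThreeConnected A) where

  private
    r : Subset n → ℕ
    r = rank A

  no-separation : ∀ k → 1 ≤ k → k < 3 → ∀ X → k ≤ ∣ X ∣ → k ≤ ∣ ∁ X ∣ → k + r ⊤ ≤ r X + r (∁ X)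
  no-separation k 1≤k k<3 X k≤∣X∣ k≤∣∁X∣ = ≮⇒≥ (λ deficient → tc k 1≤k k<3 X (separation A k X k≤∣X∣ k≤∣∁X∣ deficient))

  no-1-separation-⁅⁆ : ∀ i → 1 + r ⊤ ≤ r ⁅ i ⁆ + r (∁ ⁅ i ⁆)
  no-1-separation-⁅⁆ i = no-separation 1 ≤-refl (s≤s (s≤s z≤n)) ⁅ i ⁆ (subst (1 ≤_) (sym (∣⁅x⁆∣≡1 i)) ≤-refl) ∣∁⁅i⁆∣
    where
    ∣∁⁅i⁆∣ : 1 ≤ ∣ ∁ ⁅ i ⁆ ∣
    ∣∁⁅i⁆∣ = subst (1 ≤_) (sym (trans (∣∁p∣≡n∸∣p∣ ⁅ i ⁆) (cong (n ∸_) (∣⁅x⁆∣≡1 i))))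
                   (≤-trans (s≤s z≤n) (∸-monoˡ-≤ 1 4≤n))

  rank-⁅⁆≤1 : ∀ i → r ⁅ i ⁆ ≤ 1
  rank-⁅⁆≤1 i = subst (r ⁅ i ⁆ ≤_) (∣⁅x⁆∣≡1 i) (rank≤card A ⁅ i ⁆)

  rank-⁅⁆≥1 : ∀ i → 1 ≤ r ⁅ i ⁆
  rank-⁅⁆≥1 i = +-cancelʳ-≤ (r ⊤) 1 (r ⁅ i ⁆)
    (≤-trans (no-1-separation-⁅⁆ i) (+-monoʳ-≤ (r ⁅ i ⁆) (rank-mono A ⊆⊤)))

  no-coloop : ∀ i → r ⊤ ≤ r (∁ ⁅ i ⁆)
  no-coloop i = ≤-pred (≤-trans (no-1-separation-⁅⁆ i) (+-monoˡ-≤ (r (∁ ⁅ i ⁆)) (rank-⁅⁆≤1 i)))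

  -- Two distinct columns are independent: the pair is a candidate 2-separation.
  rank-pair : ∀ i j → i ≢ j → 2 ≤ r (pair i j)
  rank-pair i j i≢j = +-cancelʳ-≤ (r ⊤) 2 (r (pair i j))
    (≤-trans (no-separation 2 (s≤s z≤n) ≤-refl (pair i j) (subst (2 ≤_) (sym (∣pair∣≡2 i j i≢j)) ≤-refl) ∣∁pair∣)
             (+-monoʳ-≤ (r (pair i j)) (rank-mono A ⊆⊤)))
    where
    ∣∁pair∣ : 2 ≤ ∣ ∁ (pair i j) ∣
    ∣∁pair∣ = subst (2 ≤_) (sym (trans (∣∁p∣≡n∸∣p∣ (pair i j)) (cong (n ∸_) (∣pair∣≡2 i j i≢j))))
                    (≤-trans (s≤s (s≤s z≤n)) (∸-monoˡ-≤ 2 4≤n))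

  injective : ∀ i j → i ≢ j → A i ≢ A j
  injective i j i≢j Ai≡Aj =
    <⇒≱ (s≤s (s≤s z≤n)) (≤-trans (rank-pair i j i≢j) (≤-trans (rank-spans A ⁅i⁆↠pair) (rank-⁅⁆≤1 i)))
    where
    ⁅i⁆↠pair : Spans A ⁅ i ⁆ (pair i j)
    ⁅i⁆↠pair t∈ with ∈-pair⁻ t∈
    ... | inj₁ refl = span-el A (x∈⁅x⁆ i)
    ... | inj₂ refl = subst (InSpan A ⁅ i ⁆) Ai≡Aj (span-el A (x∈⁅x⁆ i))

-- One-row lifts.  c is a lift of A through e when e is the unit column (1;0),
-- deleting the top row maps the other columns onto the columns of A, and the
-- columns other than e are pairwise distinct.  Γ(A,v) is such a lift.

record LiftOf {m n N} (A : Fin n → Vec Bool m) (c : Fin N → Vec Bool (suc m)) (e : Fin N) : Set where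
  field
    unit     : c e ≡ true ∷ 0v
    below    : ∀ x → x ≢ e → ∃ λ i → tail (c x) ≡ A i
    onto     : ∀ i → ∃ λ x → x ≢ e × tail (c x) ≡ A i
    distinct : ∀ x y → x ≢ e → y ≢ e → c x ≡ c y → x ≡ y

select : ∀ {n} {P : Fin n → Set} → (∀ i → Dec (P i)) → Subset n
select P? = tabulate (λ i → isYes (P? i))

select⁻ : ∀ {n} {P : Fin n → Set} (P? : ∀ i → Dec (P i)) {i} → i ∈ select P? → P i
select⁻ P? {i} i∈ with P? i | trans (sym (VecP.lookup∘tabulate (λ j → isYes (P? j)) i)) (∈⇒lookup i∈)
... | yes Pi | _ = Pi
... | no  _  | ()

select⁺ : ∀ {n} {P : Fin n → Set} (P? : ∀ i → Dec (P i)) {i} → P i → i ∈ select P?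
select⁺ P? {i} Pi = lookup⇒∈ (trans (VecP.lookup∘tabulate (λ j → isYes (P? j)) i) (is-yes (P? i)))
  where
  is-yes : (d : Dec _) → isYes d ≡ true
  is-yes (yes _)  = refl
  is-yes (no ¬Pi) = ⊥-elim (¬Pi Pi)

module LiftRanks {m n N} {A : Fin n → Vec Bool m} {c : Fin N → Vec Bool (suc m)} {e : Fin N}
                 (lift : LiftOf A c e) where

  open LiftOf lift

  Below : Subset N → Fin n → Set
  Below S i = ∃ λ x → x ∈ S × x ≢ e × tail (c x) ≡ A i

  π : Subset N → Subset n
  π S = select (λ i → FinP.any? (λ x → (x ∈? S) ×-dec ¬? (x FinP.≟ e) ×-dec (tail (c x) ≟v A i)))

  π⁻ : ∀ {S i} → i ∈ π S → Below S i
  π⁻ = select⁻ _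

  π⁺ : ∀ {S i x} → x ∈ S → x ≢ e → tail (c x) ≡ A i → i ∈ π S
  π⁺ x∈S x≢e tail≡ = select⁺ _ (_ , x∈S , x≢e , tail≡)

  same-column : ∀ {x y} → x ≢ e → y ≢ e → head (c x) ≡ head (c y) → tail (c x) ≡ tail (c y) → x ≡ y
  same-column {x} {y} x≢e y≢e heads tails =
    distinct x y x≢e y≢e (trans (head∷tail (c x)) (trans (cong₂ _∷_ heads tails) (sym (head∷tail (c y)))))

  -- The matrix [1 0 ; 0 A]: the unit column followed by A padded with a zero row.
  padded : Fin (suc n) → Vec Bool (suc m)
  padded zero    = true ∷ 0v
  padded (suc i) = false ∷ A i

  colSum-padded : ∀ b Z w → colSum A Z ≡ w → colSum padded (b ∷ Z) ≡ b ∷ w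
  colSum-padded true  Z w ΣZ = trans (cong ((true ∷ 0v) ⊕_) (colSum-pad A Z)) (cong (true ∷_) (trans (⊕-identityˡ _) ΣZ))
  colSum-padded false Z w ΣZ = trans (colSum-pad A Z) (cong (false ∷_) ΣZ)

  padded-indep : ∀ {I} → Indep A I → Indep padded (true ∷ I)
  padded-indep ind (true ∷ Y)  Y⊆ Y≢∅ ΣY≡0 with cong head (trans (sym (colSum-padded true Y _ refl)) ΣY≡0)
  ... | ()
  padded-indep ind (false ∷ Y) Y⊆ (zero , ()) ΣY≡0
  padded-indep ind (false ∷ Y) Y⊆ (suc y , there y∈Y) ΣY≡0 =
    ind Y (λ z∈ → drop-there (Y⊆ (there z∈))) (y , y∈Y) (cong tail (trans (sym (colSum-padded false Y _ refl)) ΣY≡0))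

  -- The columns below S span nothing more than S does.
  rank-π≤ : ∀ S → rank A (π S) ≤ rank c S
  rank-π≤ S = steinitz A (λ x → tail (c x)) (basis A (π S)) (basis c S) (basis-indep A (π S)) tails-span
    where
    tails-span : ∀ {i} → i ∈ basis A (π S) → InSpan (λ x → tail (c x)) (basis c S) (A i)
    tails-span i∈ with π⁻ (basis⊆ A (π S) i∈)
    ... | x , x∈S , x≢e , tail≡ with basis-spans c S x∈S
    ... | Z , Z⊆ , ΣZ = Z , Z⊆ , trans (sym (colSum-tail c Z)) (trans (cong tail ΣZ) tail≡)

  -- Every column of S ∪ e is spanned by the unit column and the padded basis of π S.
  rank-∪e≤ : ∀ S → rank c (S ∪ ⁅ e ⁆) ≤ suc (rank A (π S))
  rank-∪e≤ S = steinitz c padded (basis c (S ∪ ⁅ e ⁆)) (true ∷ I) (basis-indep c (S ∪ ⁅ e ⁆)) padded-spans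
    where
    I : Subset n
    I = basis A (π S)
    padded-spans : ∀ {x} → x ∈ basis c (S ∪ ⁅ e ⁆) → InSpan padded (true ∷ I) (c x)
    padded-spans {x} x∈ with x FinP.≟ e
    ... | yes refl = subst (InSpan padded (true ∷ I)) (sym unit) (span-el padded {x = zero} here)
    ... | no  x≢e with below x x≢e
    ... | i , tail≡ with basis-spans A (π S) (π⁺ (∈-∪⁅⁆ (basis⊆ c (S ∪ ⁅ e ⁆) x∈) x≢e) x≢e tail≡)
    ... | Z , Z⊆I , ΣZ = head (c x) ∷ Z , ∷⊆ Z⊆I ,
          trans (colSum-padded (head (c x)) Z (A i) ΣZ) (sym (trans (head∷tail (c x)) (cong (head (c x) ∷_) tail≡)))
      where
      ∷⊆ : ∀ {b} → Z ⊆ I → b ∷ Z ⊆ true ∷ I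
      ∷⊆ Z⊆ here       = here
      ∷⊆ Z⊆ (there z∈) = there (Z⊆ z∈)

  -- Conversely S ∪ e spans the unit column and every padded column of π S.
  rank-∪e≥ : ∀ S → suc (rank A (π S)) ≤ rank c (S ∪ ⁅ e ⁆)
  rank-∪e≥ S = steinitz padded c (true ∷ I) K (padded-indep (basis-indep A (π S))) K-spans
    where
    I : Subset n
    I = basis A (π S)
    K : Subset N
    K = basis c (S ∪ ⁅ e ⁆)
    unit∈ : InSpan c K (true ∷ 0v)
    unit∈ = subst (InSpan c K) unit (basis-spans c (S ∪ ⁅ e ⁆) (x∈p∪q⁺ (inj₂ (x∈⁅x⁆ e))))
    K-spans : ∀ {j} → j ∈ true ∷ I → InSpan c K (padded j)
    K-spans {zero}  _          = unit∈
    K-spans {suc i} (there i∈) with π⁻ (basis⊆ A (π S) i∈)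
    ... | x , x∈S , _ , tail≡ = clear-top (head (c x)) (trans (head∷tail (c x)) (cong (head (c x) ∷_) tail≡))
      where
      x∈ : InSpan c K (c x)
      x∈ = basis-spans c (S ∪ ⁅ e ⁆) (x∈p∪q⁺ (inj₁ x∈S))
      -- If the top entry of c x is 1, add the unit column to clear it.
      clear-top : ∀ b → c x ≡ b ∷ A i → InSpan c K (false ∷ A i)
      clear-top false cx≡ = subst (InSpan c K) cx≡ x∈
      clear-top true  cx≡ = subst (InSpan c K) (trans (cong (_⊕ (true ∷ 0v)) cx≡) (cong (false ∷_) (⊕-identityʳ (A i))))
                                  (span-⊕ c x∈ unit∈)

  rank-⊤ : rank c ⊤ ≡ suc (rank A ⊤)
  rank-⊤ = ≤-antisym (≤-trans (rank-mono c (p⊆p∪q ⁅ e ⁆)) (≤-trans (rank-∪e≤ ⊤) (s≤s (rank-mono A ⊆⊤))))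
                     (≤-trans (s≤s (rank-mono A ⊤⊆π⊤)) (≤-trans (rank-∪e≥ ⊤) (rank-mono c ⊆⊤)))
    where
    ⊤⊆π⊤ : ⊤ ⊆ π ⊤
    ⊤⊆π⊤ {i} _ = let (x , x≢e , tail≡) = onto i in π⁺ ∈⊤ x≢e tail≡

module LiftSeparations {m n N} {A : Fin n → Vec Bool m} {c : Fin N → Vec Bool (suc m)} {e : Fin N}
    (lift : LiftOf A c e) (4≤n : 4 ≤ n) (tc : ThreeConnected A) (cs : Cosimple c) where

  open LiftOf lift
  open LiftRanks lift
  open ThreeConnectedMatrix A 4≤n tc

  private
    ρ : Subset N → ℕ
    ρ = rank c
    r : Subset n → ℕ
    r = rank A

  point-deletion-full : ∀ {u S} → ∁ ⁅ u ⁆ ⊆ S → ρ ⊤ ≤ ρ S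
  point-deletion-full {u} ⊆S = ≤-trans (cosimple⇒no-coloop c cs u) (rank-mono c ⊆S)

  pair-deletion-full : ∀ {u v S} → u ≢ v → ∁ (pair u v) ⊆ S → ρ ⊤ ≤ ρ S
  pair-deletion-full {u} {v} u≢v ⊆S = ≤-trans (cosimple⇒no-series-pair c cs u v u≢v) (rank-mono c ⊆S)

  top-differs : ∀ {u w} → u ≢ e → w ≢ e → u ≢ w → tail (c u) ≡ tail (c w) → head (c u) ≢ head (c w)
  top-differs u≢e w≢e u≢w tails heads = u≢w (same-column u≢e w≢e heads tails)

  unit-sum : ∀ {u w} → u ≢ e → w ≢ e → u ≢ w → tail (c u) ≡ tail (c w) → c e ≡ c u ⊕ c w
  unit-sum {u} {w} u≢e w≢e u≢w tails = begin
    c e                                        ≡⟨ unit ⟩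
    true ∷ 0v                                  ≡⟨ sym (⊕-top (tail (c u)) (top-differs u≢e w≢e u≢w tails)) ⟩
    (head (c u) ∷ tail (c u)) ⊕ (head (c w) ∷ tail (c u))
                                               ≡⟨ cong₂ _⊕_ (sym (head∷tail (c u)))
                                                    (trans (cong (head (c w) ∷_) tails) (sym (head∷tail (c w)))) ⟩
    c u ⊕ c w                                  ∎
    where open ≡-Reasoning

  one-of-two : ∀ {u w z} → u ≢ e → w ≢ e → z ≢ e → u ≢ w → tail (c u) ≡ tail (c w) →
    tail (c z) ≡ tail (c u) → z ≡ u ⊎ z ≡ w
  one-of-two {u} {w} {z} u≢e w≢e z≢e u≢w tails tail-z with bool-dichotomy (top-differs u≢e w≢e u≢w tails) (head (c z))
  ... | inj₁ head-z = inj₁ (same-column z≢e u≢e head-z tail-z)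
  ... | inj₂ head-z = inj₂ (same-column z≢e w≢e head-z (trans tail-z tails))

  module Split (X : Subset N) (e∈X : e ∈ X) where

    Y : Subset N
    Y = ∁ X
    P Q : Subset n
    P = π X
    Q = π Y

    Y∌e : ∀ {y} → y ∈ Y → y ≢ e
    Y∌e y∈Y refl = x∈∁p⇒x∉p y∈Y e∈X

    -- X = X ∪ e, so ρ X = 1 + r P.
    rank-X : suc (r P) ≤ ρ X
    rank-X = ≤-trans (rank-∪e≥ X) (rank-mono c (λ z∈ → [ (λ z∈X → z∈X) , (λ z∈e → ⁅⁆⊆ e∈X z∈e) ] (x∈p∪q⁻ X ⁅ e ⁆ z∈)))

    below-X : ∀ {x} → x ∈ X → x ≢ e → ∃ λ i → i ∈ P × tail (c x) ≡ A i
    below-X {x} x∈X x≢e = let (i , tail≡) = below x x≢e in i , π⁺ x∈X x≢e tail≡ , tail≡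

    below-Y : ∀ {y} → y ∈ Y → ∃ λ i → i ∈ Q × tail (c y) ≡ A i
    below-Y {y} y∈Y = let (i , tail≡) = below y (Y∌e y∈Y) in i , π⁺ y∈Y (Y∌e y∈Y) tail≡ , tail≡

    other-than-e : 2 ≤ ∣ X ∣ → ∃ λ x → x ∈ X × x ≢ e
    other-than-e 2≤∣X∣ with two-elements X 2≤∣X∣
    ... | u , w , u∈X , w∈X , u≢w with u FinP.≟ e
    ...   | yes refl = w , w∈X , (λ w≡e → u≢w (sym w≡e))
    ...   | no  u≢e  = u , u∈X , u≢e

    ∁Q⊆P : ∀ {i} → i ∉ Q → i ∈ P
    ∁Q⊆P {i} i∉Q with onto i
    ... | x , x≢e , tail≡ with x ∈? X
    ... | yes x∈X = π⁺ x∈X x≢e tail≡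
    ... | no  x∉X = ⊥-elim (i∉Q (π⁺ (x∉p⇒x∈∁p x∉X) x≢e tail≡))

    projected-deficit : ∀ {k} → ρ X + ρ Y < k + ρ ⊤ → r P + r Q < k + r ⊤
    projected-deficit {k} deficit = ≤-pred (begin
      suc (suc (r P + r Q))     ≤⟨ s≤s (+-mono-≤ rank-X (rank-π≤ Y)) ⟩
      suc (ρ X + ρ Y)           ≤⟨ deficit ⟩
      k + ρ ⊤                   ≡⟨ cong (k +_) rank-⊤ ⟩
      k + suc (r ⊤)             ≡⟨ +-suc k (r ⊤) ⟩
      suc (k + r ⊤)             ∎)
      where open ≤-Reasoning

    -- Hence (Q, ∁ Q) would be a k-separation of A if both sides were large.
    shadow-separation : ∀ k → 1 ≤ k → k < 3 → ρ X + ρ Y < k + ρ ⊤ → k ≤ ∣ Q ∣ → k ≤ ∣ ∁ Q ∣ → False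
    shadow-separation k 1≤k k<3 deficit k≤∣Q∣ k≤∣∁Q∣ =
      <⇒≱ (≤-<-trans (+-monoʳ-≤ (r Q) ∁Q-rank) (sum<-swap (r P) (r Q) (projected-deficit deficit)))
          (no-separation k 1≤k k<3 Q k≤∣Q∣ k≤∣∁Q∣)
      where
      ∁Q-rank : r (∁ Q) ≤ r P
      ∁Q-rank = rank-mono A (λ i∈ → ∁Q⊆P (x∈∁p⇒x∉p i∈))

    -- If at most one column of A misses Q, then Q has full rank (no coloops in A),
    -- and the whole deficit is carried by P.
    Q-full : ∣ ∁ Q ∣ ≤ 1 → r ⊤ ≤ r Q
    Q-full ∣∁Q∣≤1 with FinP.any? (λ i → ¬? (i ∈? Q))
    ... | no  Q-all        = rank-mono A (λ {i} _ → x∉∁p⇒x∈p (λ i∈∁Q → Q-all (i , x∈∁p⇒x∉p i∈∁Q)))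
    ... | yes (i₀ , i₀∉Q) = ≤-trans (no-coloop i₀) (rank-mono A ∁⁅i₀⁆⊆Q)
      where
      ∁⁅i₀⁆⊆Q : ∁ ⁅ i₀ ⁆ ⊆ Q
      ∁⁅i₀⁆⊆Q {i} i∈ with i ∈? Q
      ... | yes i∈Q = i∈Q
      ... | no  i∉Q = ⊥-elim (x∈∁p⇒x∉p i∈ (subst (_∈ ⁅ i₀ ⁆)
                        (∣∣≤1⇒≡ (∁ Q) ∣∁Q∣≤1 (x∉p⇒x∈∁p i₀∉Q) (x∉p⇒x∈∁p i∉Q)) (x∈⁅x⁆ i₀)))

    P-deficient : ∀ {k} → ρ X + ρ Y < k + ρ ⊤ → ∣ ∁ Q ∣ ≤ 1 → r P < k
    P-deficient deficit ∣∁Q∣≤1 = sum<⇒left< (projected-deficit deficit) (Q-full ∣∁Q∣≤1)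

    ∁pair⊆ : ∀ {u S} → Y ⊆ S → (∀ {z} → z ∈ X → z ≢ e → z ≢ u → z ∈ S) → ∁ (pair e u) ⊆ S
    ∁pair⊆ {u} {S} Y⊆S rest⊆S {z} z∈ with z ∈? X
    ... | no  z∉X = Y⊆S (x∉p⇒x∈∁p z∉X)
    ... | yes z∈X = rest⊆S z∈X (λ z≡e → x∈∁p⇒x∉p z∈ (subst (_∈ pair e u) (sym z≡e) ∈-pair₁))
                               (λ z≡u → x∈∁p⇒x∉p z∈ (subst (_∈ pair e u) (sym z≡u) ∈-pair₂))

    -- No 1-separation: Q is nonempty, and if ∁ Q were empty then X = {e} and e
    -- would be a coloop.
    no-1-separation : 1 ≤ ∣ Y ∣ → ρ X + ρ Y < 1 + ρ ⊤ → False
    no-1-separation 1≤∣Y∣ deficit with 1 ≤? ∣ ∁ Q ∣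
    ... | yes 1≤∣∁Q∣ = let (y , y∈Y) = element Y 1≤∣Y∣ ; (i , i∈Q , _) = below-Y y∈Y in
                       shadow-separation 1 ≤-refl (s≤s (s≤s z≤n)) deficit (∈⇒1≤∣∣ i∈Q) 1≤∣∁Q∣
    ... | no  ∁Q-empty = <⇒≱ ρY<ρ⊤ (point-deletion-full ∁⁅e⁆⊆Y)
      where
      rP<1 : r P < 1
      rP<1 = P-deficient deficit (≤-trans (≤-pred (≰⇒> ∁Q-empty)) z≤n)
      X⊆⁅e⁆ : ∀ {z} → z ∈ X → z ≡ e
      X⊆⁅e⁆ {z} z∈X with z FinP.≟ e
      ... | yes z≡e = z≡e
      ... | no  z≢e = let (i , i∈P , _) = below-X z∈X z≢e in
                      ⊥-elim (<⇒≱ rP<1 (≤-trans (rank-⁅⁆≥1 i) (rank-mono A (⁅⁆⊆ i∈P))))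
      ∁⁅e⁆⊆Y : ∁ ⁅ e ⁆ ⊆ Y
      ∁⁅e⁆⊆Y z∈ = x∉p⇒x∈∁p (λ z∈X → x∈∁p⇒x∉p z∈ (subst (_∈ ⁅ e ⁆) (sym (X⊆⁅e⁆ z∈X)) (x∈⁅x⁆ e)))
      ρY<ρ⊤ : ρ Y < ρ ⊤
      ρY<ρ⊤ = sum<⇒right< deficit (≤-trans (s≤s z≤n) rank-X)

    -- By cosimplicity Y ∪ x₁ = ∁ {e, x₂}
    -- spans c x₂; either Y alone spans c x₂, making {e, x₁} a series pair, or Y
    -- spans c x₂ ⊕ c x₁ = c e, contradicting ρ (Y ∪ e) = 1 + r Q ≥ ρ ⊤ > ρ Y.
    no-two-over-one : ρ Y < ρ ⊤ → r ⊤ ≤ r Q → ∀ {x₁ x₂} → x₁ ≢ e → x₂ ≢ e → x₁ ≢ x₂ →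
      tail (c x₁) ≡ tail (c x₂) → (∀ {z} → z ∈ X → z ≢ e → z ≡ x₁ ⊎ z ≡ x₂) → False
    no-two-over-one ρY<ρ⊤ Q-full-rank {x₁} {x₂} x₁≢e x₂≢e x₁≢x₂ tails one-of-x₁x₂ =
      [ x₂-spanned , unit-spanned ] (span-∪⁅⁆⁻ c (full-rank⇒spans c Y∪x₁-full x₂))
      where
      ∁pair⊆Y∪ : ∀ {u w} → (∀ {z} → z ∈ X → z ≢ e → z ≢ u → z ≡ w) → ∁ (pair e u) ⊆ Y ∪ ⁅ w ⁆
      ∁pair⊆Y∪ {u} {w} only = ∁pair⊆ (p⊆p∪q ⁅ w ⁆)
        (λ z∈X z≢e z≢u → x∈p∪q⁺ (inj₂ (subst (_∈ ⁅ w ⁆) (sym (only z∈X z≢e z≢u)) (x∈⁅x⁆ w))))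
      Y∪x₁-full : ρ ⊤ ≤ ρ (Y ∪ ⁅ x₁ ⁆)
      Y∪x₁-full = pair-deletion-full (λ e≡x₂ → x₂≢e (sym e≡x₂))
        (∁pair⊆Y∪ (λ z∈X z≢e z≢x₂ → [ (λ z≡x₁ → z≡x₁) , (λ z≡x₂ → ⊥-elim (z≢x₂ z≡x₂)) ] (one-of-x₁x₂ z∈X z≢e)))
      x₂-spanned : InSpan c Y (c x₂) → False
      x₂-spanned x₂∈span = <⇒≱ (≤-<-trans (rank-absorb c Y x₂ x₂∈span) ρY<ρ⊤)
        (pair-deletion-full (λ e≡x₁ → x₁≢e (sym e≡x₁))
          (∁pair⊆Y∪ (λ z∈X z≢e z≢x₁ → [ (λ z≡x₁ → ⊥-elim (z≢x₁ z≡x₁)) , (λ z≡x₂ → z≡x₂) ] (one-of-x₁x₂ z∈X z≢e))))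
      unit-spanned : InSpan c Y (c x₂ ⊕ c x₁) → False
      unit-spanned sum∈span = <⇒≱ ρY<ρ⊤ (begin
        ρ ⊤                   ≡⟨ rank-⊤ ⟩
        suc (r ⊤)             ≤⟨ s≤s Q-full-rank ⟩
        suc (r Q)             ≤⟨ rank-∪e≥ Y ⟩
        ρ (Y ∪ ⁅ e ⁆)         ≤⟨ rank-absorb c Y e unit∈span ⟩
        ρ Y                   ∎)
        where
        open ≤-Reasoning
        unit∈span : InSpan c Y (c e)
        unit∈span = subst (InSpan c Y) (trans (⊕-comm (c x₂) (c x₁)) (sym (unit-sum x₁≢e x₂≢e x₁≢x₂ tails))) sum∈span

    module TwoSeparation (2≤∣X∣ : 2 ≤ ∣ X ∣) (2≤∣Y∣ : 2 ≤ ∣ Y ∣) (deficit : ρ X + ρ Y < 2 + ρ ⊤) where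

      -- If ∣ Q ∣ ≤ 1, all of Y lies over one column of A, so Y = {y₁, y₂} with
      -- c e = c y₁ ⊕ c y₂.  Then ρ Y ≥ 2, so ρ X < ρ ⊤: {y₁, y₂} is a series pair.
      Q-not-small : ∣ Q ∣ ≤ 1 → False
      Q-not-small ∣Q∣≤1 with two-elements Y 2≤∣Y∣
      ... | y₁ , y₂ , y₁∈Y , y₂∈Y , y₁≢y₂ with below-Y y₁∈Y
      ... | i₁ , i₁∈Q , tail₁ = <⇒≱ ρX<ρ⊤ (pair-deletion-full y₁≢y₂ ∁pair⊆X)
        where
        same-tail : ∀ {z} → z ∈ Y → tail (c z) ≡ tail (c y₁)
        same-tail z∈Y with below-Y z∈Y
        ... | i , i∈Q , tail≡ = trans tail≡ (trans (cong A (∣∣≤1⇒≡ Q ∣Q∣≤1 i∈Q i₁∈Q)) (sym tail₁))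
        tails : tail (c y₁) ≡ tail (c y₂)
        tails = sym (same-tail y₂∈Y)
        ∁pair⊆X : ∁ (pair y₁ y₂) ⊆ X
        ∁pair⊆X {z} z∈ = x∉∁p⇒x∈p λ z∈Y →
          x∈∁p⇒x∉p z∈ ([ (λ z≡y₁ → subst (_∈ pair y₁ y₂) (sym z≡y₁) ∈-pair₁) ,
                         (λ z≡y₂ → subst (_∈ pair y₁ y₂) (sym z≡y₂) ∈-pair₂) ]
                       (one-of-two (Y∌e y₁∈Y) (Y∌e y₂∈Y) (Y∌e z∈Y) y₁≢y₂ tails (same-tail z∈Y)))
        unit∈span : InSpan c Y (c e)
        unit∈span = subst (InSpan c Y) (sym (unit-sum (Y∌e y₁∈Y) (Y∌e y₂∈Y) y₁≢y₂ tails))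
                          (span-⊕ c (span-el c y₁∈Y) (span-el c y₂∈Y))
        2≤ρY : 2 ≤ ρ Y
        2≤ρY = ≤-trans (s≤s (≤-trans (rank-⁅⁆≥1 i₁) (rank-mono A (⁅⁆⊆ i₁∈Q))))
                       (≤-trans (rank-∪e≥ Y) (rank-absorb c Y e unit∈span))
        ρX<ρ⊤ : ρ X < ρ ⊤
        ρX<ρ⊤ = sum<⇒right< (sum<-swap (ρ X) (ρ Y) deficit) 2≤ρY

      -- If ∣ ∁ Q ∣ ≤ 1, then r P ≤ 1: all of X - e lies over one column of A, so
      -- X - e has one element x₁, making {e, x₁} a series pair, or two, which
      -- no-two-over-one excludes.
      ∁Q-not-small : ∣ ∁ Q ∣ ≤ 1 → False
      ∁Q-not-small ∣∁Q∣≤1 with other-than-e 2≤∣X∣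
      ... | x₁ , x₁∈X , x₁≢e with below-X x₁∈X x₁≢e
      ... | i₀ , i₀∈P , tail₀ = one-or-two (FinP.any? (λ z → (z ∈? X) ×-dec ¬? (z FinP.≟ e) ×-dec ¬? (z FinP.≟ x₁)))
        where
        rP≤1 : r P ≤ 1
        rP≤1 = ≤-pred (P-deficient deficit ∣∁Q∣≤1)
        ρY<ρ⊤ : ρ Y < ρ ⊤
        ρY<ρ⊤ = sum<⇒right< deficit (≤-trans (s≤s (≤-trans (rank-⁅⁆≥1 i₀) (rank-mono A (⁅⁆⊆ i₀∈P)))) rank-X)
        -- every element of X - e lies over A i₀, since r P ≤ 1
        same-tail : ∀ {z} → z ∈ X → z ≢ e → tail (c z) ≡ tail (c x₁)
        same-tail z∈X z≢e with below-X z∈X z≢e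
        ... | i , i∈P , tail≡ with i FinP.≟ i₀
        ...   | yes refl = trans tail≡ (sym tail₀)
        ...   | no  i≢i₀ = ⊥-elim (<⇒≱ (s≤s rP≤1) (≤-trans (rank-pair i i₀ i≢i₀) (rank-mono A (pair⊆ i∈P i₀∈P))))
        one-or-two : Dec (∃ λ z → z ∈ X × z ≢ e × z ≢ x₁) → False
        one-or-two (no only-x₁) =
          <⇒≱ ρY<ρ⊤ (pair-deletion-full (λ e≡x₁ → x₁≢e (sym e≡x₁))
                      (∁pair⊆ (λ y∈ → y∈) (λ {z} z∈X z≢e z≢x₁ → ⊥-elim (only-x₁ (z , z∈X , z≢e , z≢x₁)))))
        one-or-two (yes (x₂ , x₂∈X , x₂≢e , x₂≢x₁)) =
          no-two-over-one ρY<ρ⊤ (Q-full ∣∁Q∣≤1) x₁≢e x₂≢e x₁≢x₂ tails one-of-x₁x₂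
          where
          x₁≢x₂ : x₁ ≢ x₂
          x₁≢x₂ x₁≡x₂ = x₂≢x₁ (sym x₁≡x₂)
          tails : tail (c x₁) ≡ tail (c x₂)
          tails = sym (same-tail x₂∈X x₂≢e)
          one-of-x₁x₂ : ∀ {z} → z ∈ X → z ≢ e → z ≡ x₁ ⊎ z ≡ x₂
          one-of-x₁x₂ z∈X z≢e = one-of-two x₁≢e x₂≢e z≢e x₁≢x₂ tails (same-tail z∈X z≢e)

      no-2-separation : False
      no-2-separation with 2 ≤? ∣ Q ∣ | 2 ≤? ∣ ∁ Q ∣
      ... | yes 2≤∣Q∣ | yes 2≤∣∁Q∣ = shadow-separation 2 (s≤s z≤n) ≤-refl deficit 2≤∣Q∣ 2≤∣∁Q∣
      ... | no  ∣Q∣<2 | _          = Q-not-small (≤-pred (≰⇒> ∣Q∣<2))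
      ... | yes _     | no ∣∁Q∣<2  = ∁Q-not-small (≤-pred (≰⇒> ∣∁Q∣<2))

  no-separation-containing-e : ∀ k → 1 ≤ k → k < 3 → ∀ X → e ∈ X → ¬ Separation c k X
  no-separation-containing-e 1 _ _ X e∈X sep@(_ , 1≤∣Y∣ , _) =
    Split.no-1-separation X e∈X 1≤∣Y∣ (separation-deficient c sep)
  no-separation-containing-e 2 _ _ X e∈X sep@(2≤∣X∣ , 2≤∣Y∣ , _) =
    Split.TwoSeparation.no-2-separation X e∈X 2≤∣X∣ 2≤∣Y∣ (separation-deficient c sep)
  no-separation-containing-e (suc (suc (suc _))) _ (s≤s (s≤s (s≤s ()))) _ _ _

  -- Separations are symmetric, so we may assume e lies on the first side.
  three-connected : ThreeConnected c
  three-connected k 1≤k k<3 X sep with e ∈? X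
  ... | yes e∈X = no-separation-containing-e k 1≤k k<3 X e∈X sep
  ... | no  e∉X = no-separation-containing-e k 1≤k k<3 (∁ X) (x∉p⇒x∈∁p e∉X) (separation-swap c sep)

lookup-injective : ∀ {a} {B : Set a} {xs : List B} → Unique xs → ∀ i j → List.lookup xs i ≡ List.lookup xs j → i ≡ j
lookup-injective (_ ∷ _)      zero    zero    _  = refl
lookup-injective (x∉ ∷ _)     zero    (suc j) eq = ⊥-elim (All.lookup x∉ (∈-lookup j) eq)
lookup-injective (x∉ ∷ _)     (suc i) zero    eq = ⊥-elim (All.lookup x∉ (∈-lookup i) (sym eq))
lookup-injective (_ ∷ unique) (suc i) (suc j) eq = cong suc (lookup-injective unique i j eq)

-- Γ(A,v) is a lift of A through its first column, provided the columns of A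
-- are distinct: the middle columns (v̄ᵢ ; Aᵢ) cover A, and the extra columns
-- (1 ; Aᵢ) for vᵢ = 2 repeat no middle column because then v̄ᵢ = 0.

module GammaLift {m n} (A : Fin n → Vec Bool m) (v : Fin n → Fin 3)
                 (A-injective : ∀ i j → i ≢ j → A i ≢ A j) where

  injective : ∀ {i j} → A i ≡ A j → i ≡ j
  injective {i} {j} Ai≡Aj with i FinP.≟ j
  ... | yes i≡j = i≡j
  ... | no  i≢j = ⊥-elim (A-injective i j i≢j Ai≡Aj)

  middle : Fin n → Vec Bool (suc m)
  middle i = parity (v i) ∷ A i

  middleCols≡ : ∀ {n} (A : Fin n → Vec Bool m) (v : Fin n → Fin 3) →
    middleCols A v ≡ List.tabulate (λ i → parity (v i) ∷ A i)
  middleCols≡ {zero}  A v = refl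
  middleCols≡ {suc n} A v = cong ((parity (v zero) ∷ A zero) ∷_) (middleCols≡ (λ i → A (suc i)) (λ i → v (suc i)))

  middle∈⁻ : ∀ {w} → w ∈ₗ middleCols A v → ∃ λ i → w ≡ middle i
  middle∈⁻ {w} w∈ = ∈-tabulate⁻ (subst (w ∈ₗ_) (middleCols≡ A v) w∈)

  middle∈⁺ : ∀ i → middle i ∈ₗ middleCols A v
  middle∈⁺ i = subst (middle i ∈ₗ_) (sym (middleCols≡ A v)) (∈-tabulate⁺ i)

  middle-unique : Unique (middleCols A v)
  middle-unique = subst Unique (sym (middleCols≡ A v)) (Unique.tabulate⁺ (λ eq → injective (cong tail eq)))

  twoCols∈⁻ : ∀ {n} (A : Fin n → Vec Bool m) (v : Fin n → Fin 3) {w} → w ∈ₗ twoCols A v →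
    ∃ λ j → isTwo (v j) ≡ true × w ≡ true ∷ A j
  twoCols∈⁻ {suc n} A v w∈ with isTwo (v zero) in v₀≡2
  twoCols∈⁻ {suc n} A v (Any.here refl) | true = zero , v₀≡2 , refl
  twoCols∈⁻ {suc n} A v (Any.there w∈)  | true =
    let (j , vj≡2 , w≡) = twoCols∈⁻ (λ i → A (suc i)) (λ i → v (suc i)) w∈ in suc j , vj≡2 , w≡
  twoCols∈⁻ {suc n} A v w∈              | false =
    let (j , vj≡2 , w≡) = twoCols∈⁻ (λ i → A (suc i)) (λ i → v (suc i)) w∈ in suc j , vj≡2 , w≡

  twoCols-unique : ∀ {n} (A : Fin n → Vec Bool m) (v : Fin n → Fin 3) → (∀ {i j} → A i ≡ A j → i ≡ j) →
    Unique (twoCols A v)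
  twoCols-unique {zero}  A v inj = []
  twoCols-unique {suc n} A v inj with isTwo (v zero)
  ... | false = twoCols-unique (λ i → A (suc i)) (λ i → v (suc i)) (λ eq → FinP.suc-injective (inj eq))
  ... | true  = All.tabulate new ∷ twoCols-unique (λ i → A (suc i)) (λ i → v (suc i)) (λ eq → FinP.suc-injective (inj eq))
    where
    new : ∀ {w} → w ∈ₗ twoCols (λ i → A (suc i)) (λ i → v (suc i)) → (true ∷ A zero) ≢ w
    new w∈ eq with twoCols∈⁻ (λ i → A (suc i)) (λ i → v (suc i)) w∈
    ... | j , _ , refl with inj (cong tail eq)
    ... | ()

  -- No extra column repeats a middle column, since 2 is even.
  parity-of-two : ∀ t → isTwo t ≡ true → parity t ≡ false
  parity-of-two (suc (suc zero)) _ = refl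

  disjoint : Disjoint (middleCols A v) (twoCols A v)
  disjoint (w∈middle , w∈two) with middle∈⁻ w∈middle | twoCols∈⁻ A v w∈two
  ... | i , refl | j , vj≡2 , eq with injective (cong tail eq)
  ... | refl with trans (sym (parity-of-two (v i) vj≡2)) (cong head eq)
  ... | ()

  lift : LiftOf A (Γ A v) zero
  lift = record { unit = refl ; below = below ; onto = onto ; distinct = distinct }
    where
    L : List (Vec Bool (suc m))
    L = middleCols A v ++ twoCols A v
    below : ∀ x → x ≢ zero → ∃ λ i → tail (Γ A v x) ≡ A i
    below zero    x≢0 = ⊥-elim (x≢0 refl)
    below (suc y) _   with ∈-++⁻ (middleCols A v) (∈-lookup {xs = L} y)
    ... | inj₁ w∈middle = let (i , w≡) = middle∈⁻ w∈middle in i , cong tail w≡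
    ... | inj₂ w∈two    = let (j , _ , w≡) = twoCols∈⁻ A v w∈two in j , cong tail w≡
    onto : ∀ i → ∃ λ x → x ≢ zero × tail (Γ A v x) ≡ A i
    onto i = suc (Any.index i∈L) , (λ ()) , cong tail (sym (lookup-index i∈L))
      where
      i∈L : middle i ∈ₗ L
      i∈L = ∈-++⁺ˡ (middle∈⁺ i)
    distinct : ∀ x y → x ≢ zero → y ≢ zero → Γ A v x ≡ Γ A v y → x ≡ y
    distinct zero    _       x≢0 _   _  = ⊥-elim (x≢0 refl)
    distinct _       zero    _   y≢0 _  = ⊥-elim (y≢0 refl)
    distinct (suc x) (suc y) _   _   eq =
      cong suc (lookup-injective (Unique.++⁺ middle-unique (twoCols-unique A v injective) disjoint) x y eq)

corollary8p2 : ∀ {m n : ℕ} (A : Fin n → Vec Bool m) (v : Fin n → Fin 3) →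
    4 ≤ n → ThreeConnected A → Cosimple (Γ A v) → ThreeConnected (Γ A v)
corollary8p2 A v 4≤n tc cs = LiftSeparations.three-connected Γ-is-lift 4≤n tc cs
  where
  open ThreeConnectedMatrix A 4≤n tc using (injective)
  Γ-is-lift : LiftOf A (Γ A v) zero
  Γ-is-lift = GammaLift.lift A v injective
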